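{- Let $d\geq 1$, $V=\mathbb{Z}_3^d$, $r=\frac{3^d-1}{2}$, and let $H_1,\dots,H_r$ be the $r$ linear hyperplanes (codimension-one subspaces) of $V$, labelled arbitrarily. For each $i\in\{1,\dots,r\}$ let $\pi_i:V\to\mathbb{Z}_3$ be a linear epimorphism with $\ker\pi_i=H_i$. Put $\Omega=V\times\{0,1,\dots,r\}$ and write $v_i=(v,i)$. Let $\diamond$ be a binary operation on $[0,r]=\{0,1,\dots,r\}$ such that $a\diamond a=0$ for all $a$ and, for each $a$, the map $x\mapsto a\diamond x$ is a bijection of $[0,r]$ (so $i\diamond j\in\{1,\dots,r\}$ whenever $i\neq j$). For each $0\le i<j\le r$ let $\sigma_{ij}$ be a permutation of $\mathbb{Z}_3$, and put $\sigma_{ji}=\sigma_{ij}^{ -1}$. For an array $\Sigma=(\sigma_{ij})_{0\le i<j\le r}$ define $R(\diamond,\Sigma)=\{(u_i,v_j)\in\Omega^2: i\neq j,\ \sigma_{ij}(\pi_{i\diamond j}(u))=\pi_{j\diamond i}(v)\}$. Let $S=\{(u_i,v_j):i=j,\ u\neq v\}$. For each $0\le i<j\le r$ choose a $3$-cycle $\theta_{ij}\in\{(0\,1\,2),(0\,2\,1)\}$ of $\mathbb{Z}_3$, and let $\Theta\Sigma=(\theta_{ij}\sigma_{ij})_{i<j}$, $\Theta^2\Sigma=(\theta_{ij}^2\sigma_{ij})_{i<j}$ (products of permutations; for $i>j$ the entries are again defined as inverses of the $(j,i)$ entries). Put $R_1=R(\diamond,\Sigma)$, $R_2=R(\diamond,\Theta\Sigma)$,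 $R_3=R(\diamond,\Theta^2\Sigma)$. Then $\{1_\Omega,S,R_1,R_2,R_3\}$ is a Jordan scheme on $\Omega$.
   Context: $1_\Omega=\{(\omega,\omega):\omega\in\Omega\}$. For $R\subseteq\Omega^2$: $R(\alpha)=\{\beta:(\alpha,\beta)\in R\}$, $R^\top=\{(\beta,\alpha):(\alpha,\beta)\in R\}$. A rainbow on $\Omega$ is a partition $\mathcal{C}$ of $\Omega^2$ such that $1_\Omega$ is a union of classes and $C^\top\in\mathcal{C}$ for all $C\in\mathcal{C}$. A Jordan configuration is a rainbow such that for all $C,D\in\mathcal{C}$ and all pairs $(\alpha,\beta),(\alpha',\beta')$ in the same class, $|C(\alpha)\cap D^\top(\beta)|+|D(\alpha)\cap C^\top(\beta)|=|C(\alpha')\cap D^\top(\beta')|+|D(\alpha')\cap C^\top(\beta')|$. A Jordan scheme is a Jordan configuration with $1_\Omega\in\mathcal{C}$. -}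

module Defs where

open import Data.Bool using (Bool; true; false; _∧_; not; T; if_then_else_)
open import Data.Nat using (ℕ; zero; suc; _+_; _*_)
open import Data.Nat.DivMod using (_mod_)
open import Data.Fin using (Fin; toℕ; _<_) renaming (zero to fzero; suc to fsuc)
open import Data.Fin.Properties using (<-cmp) renaming (_≟_ to _≟F_)
open import Data.Fin.Permutation using (Permutation′; _⟨$⟩ʳ_)
open import Data.Vec using (Vec; []; _∷_; zipWith) renaming (map to vmap)
open import Data.Vec.Properties using (≡-dec)
open import Data.List using (List; []; _∷_; [_]; concatMap; allFin; cartesianProduct) renaming (map to lmap)
open import Data.Product using (Σ; ∃; ∃-syntax; _×_; _,_)
open import Data.Sum using (_⊎_)
open import Relation.Binary.PropositionalEquality using (_≡_; _≢_)
open import Relation.Nullary using (¬_; does)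
open import Relation.Binary.Definitions using (tri<; tri≈; tri>)
open import Function.Bundles using (_⇔_)

-- Generic notions: counting over a finite type given by an enumeration
-- (a list containing every element exactly once), and Jordan schemes
-- whose classes are given as Bool-valued relations indexed by Fin k.

count : {Ω : Set} → List Ω → (Ω → Bool) → ℕ
count [] p = 0
count (x ∷ xs) p = (if p x then 1 else 0) + count xs p

module _ {Ω : Set} (els : List Ω) where

  -- |C(α) ∩ D^⊤(β)| = #{γ : (α,γ) ∈ C, (γ,β) ∈ D}
  meet : (C D : Ω → Ω → Bool) → Ω → Ω → ℕ
  meet C D α β = count els (λ γ → C α γ ∧ D γ β)

  IsPartition : {k : ℕ} → (Fin k → Ω → Ω → Bool) → Set
  IsPartition {k} C =
    (∀ c → ∃[ α ] ∃[ β ] T (C c α β))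
    × (∀ α β → ∃[ c ] T (C c α β))
    × (∀ α β c c′ → T (C c α β) → T (C c′ α β) → c ≡ c′)

  IsRainbow : {k : ℕ} → (Fin k → Ω → Ω → Bool) → Set
  IsRainbow {k} C =
    IsPartition C
    -- 1_Ω is a union of classes
    × (∀ c → (∀ α β → T (C c α β) → α ≡ β) ⊎ (∀ α β → T (C c α β) → α ≢ β))
    × (∀ c → ∃[ c′ ] (∀ α β → T (C c′ α β) ⇔ T (C c β α)))

  IsJordanConfiguration : {k : ℕ} → (Fin k → Ω → Ω → Bool) → Set
  IsJordanConfiguration {k} C =
    IsRainbow C
    × (∀ c d e α β α′ β′ → T (C e α β) → T (C e α′ β′) →
         meet (C c) (C d) α β + meet (C d) (C c) α β
           ≡ meet (C c) (C d) α′ β′ + meet (C d) (C c) α′ β′)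

  IsJordanScheme : {k : ℕ} → (Fin k → Ω → Ω → Bool) → Set
  IsJordanScheme {k} C =
    IsJordanConfiguration C
    × (∃[ c ] (∀ α β → T (C c α β) ⇔ (α ≡ β)))

_+₃_ : Fin 3 → Fin 3 → Fin 3
a +₃ b = (toℕ a + toℕ b) mod 3

_*₃_ : Fin 3 → Fin 3 → Fin 3
a *₃ b = (toℕ a * toℕ b) mod 3

V : ℕ → Set
V d = Vec (Fin 3) d

_+V_ : {d : ℕ} → V d → V d → V d
_+V_ = zipWith _+₃_

_·V_ : {d : ℕ} → Fin 3 → V d → V d
c ·V v = vmap (c *₃_) v

IsLinear : {d : ℕ} → (V d → Fin 3) → Set
IsLinear f = (∀ u v → f (u +V v) ≡ f u +₃ f v) × (∀ c v → f (c ·V v) ≡ c *₃ f v)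

IsSurjective : {d : ℕ} → (V d → Fin 3) → Set
IsSurjective f = ∀ y → ∃[ v ] f v ≡ y

SameKernel : {d : ℕ} → (V d → Fin 3) → (V d → Fin 3) → Set
SameKernel f g = ∀ v → (f v ≡ fzero) ⇔ (g v ≡ fzero)

allV : (d : ℕ) → List (V d)
allV zero = [ [] ]
allV (suc d) = concatMap (λ x → lmap (x ∷_) (allV d)) (allFin 3)

Ω : ℕ → ℕ → Set
Ω d r = V d × Fin (suc r)

allΩ : (d r : ℕ) → List (Ω d r)
allΩ d r = cartesianProduct (allV d) (allFin (suc r))

-- π indexed by [0,r]; index 0 is never used (i ⋄ j ≠ 0 for i ≠ j),
-- it is given the dummy value 0.
πx : {d r : ℕ} → (Fin r → V d → Fin 3) → Fin (suc r) → V d → Fin 3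
πx π fzero = λ _ → fzero
πx π (fsuc k) = π k

-- θ = true ↦ (0 1 2) : x ↦ x + 1 ;  θ = false ↦ (0 2 1) : x ↦ x + 2
cyc : Bool → Fin 3 → Fin 3
cyc true x = x +₃ fsuc fzero
cyc false x = x +₃ fsuc (fsuc fzero)

-- R(⋄, τ) where τ i j is the permutation (applied as a function) for i < j;
-- for i > j the entry is τ j i⁻¹, i.e. the condition
-- τ_{ij}(π_{i⋄j} u) = π_{j⋄i} v becomes τ_{ji}(π_{j⋄i} v) = π_{i⋄j} u.
Rel : {d r : ℕ} → (Fin r → V d → Fin 3) → (Fin (suc r) → Fin (suc r) → Fin (suc r)) →
      (Fin (suc r) → Fin (suc r) → Fin 3 → Fin 3) → Ω d r → Ω d r → Bool
Rel π _⋄_ τ (u , i) (v , j) with <-cmp i j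
... | tri< _ _ _ = does (τ i j (πx π (i ⋄ j) u) ≟F πx π (j ⋄ i) v)
... | tri≈ _ _ _ = false
... | tri> _ _ _ = does (τ j i (πx π (j ⋄ i) v) ≟F πx π (i ⋄ j) u)

One : {d r : ℕ} → Ω d r → Ω d r → Bool
One (u , i) (v , j) = does (i ≟F j) ∧ does (≡-dec _≟F_ u v)

S : {d r : ℕ} → Ω d r → Ω d r → Bool
S (u , i) (v , j) = does (i ≟F j) ∧ not (does (≡-dec _≟F_ u v))

classes : {d r : ℕ} → (Fin r → V d → Fin 3) → (Fin (suc r) → Fin (suc r) → Fin (suc r)) →
          (Fin (suc r) → Fin (suc r) → Permutation′ 3) → (Fin (suc r) → Fin (suc r) → Bool) →
          Fin 5 → Ω d r → Ω d r → Bool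
classes π _⋄_ σ θ fzero = One
classes π _⋄_ σ θ (fsuc fzero) = S
classes π _⋄_ σ θ (fsuc (fsuc fzero)) = Rel π _⋄_ (λ i j x → σ i j ⟨$⟩ʳ x)
classes π _⋄_ σ θ (fsuc (fsuc (fsuc fzero))) =
  Rel π _⋄_ (λ i j x → cyc (θ i j) (σ i j ⟨$⟩ʳ x))
classes π _⋄_ σ θ (fsuc (fsuc (fsuc (fsuc fzero)))) =
  Rel π _⋄_ (λ i j x → cyc (θ i j) (cyc (θ i j) (σ i j ⟨$⟩ʳ x)))

module Submission where

-- Write α = (u , i) and β = (v , j). A path α → (w , m) → β through R-classes constrains w only
-- through the values π_{m⋄i}(w) and π_{m⋄j}(w). If i ≠ j these are functionals with different
-- kernels (the rows of ⋄ are bijective), so every joint fibre has 3^(d-2) points and each layer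
-- m ∉ {i, j} contributes the same amount. If i = j both constraints concern π_{m⋄i}, and the
-- cyclic shifts Θ make the symmetrised count on layer m equal to 3^(d-1) times 2[π(u) = π(v)] or
-- [π(u) ≠ π(v)]; summing over m runs over all hyperplanes, and u - v (u ≠ v) lies in exactly
-- (3^(d-1) - 1)/2 of them, because the vectors annihilating u - v are 0 and the two normals ±n_h
-- of each hyperplane H_h containing u - v. Products with 1_Ω or S are plain fibre counts.

open import Defs
open import Algebra.Properties.CommutativeSemigroup using (interchange)
open import Data.Bool using (Bool; true; false; _∧_; _∨_; not; T; if_then_else_; _xor_)
open import Data.Bool.Properties using (T-≡; T-not-≡; T-∧; T-∨) renaming (_≟_ to _≟B_)
open import Data.Empty using (⊥-elim)
open import Data.Fin using (Fin) renaming (zero to fzero; suc to fsuc)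
open import Data.Fin.Permutation using (Permutation′; _⟨$⟩ʳ_; _⟨$⟩ˡ_; inverseˡ; inverseʳ)
open import Data.Fin.Properties using (<-cmp; all?; any?) renaming (_≟_ to _≟F_)
open import Data.List using (List; []; _∷_; _++_; concatMap; allFin; tabulate; cartesianProduct) renaming (map to lmap)
open import Data.Nat using (ℕ; zero; suc; _+_; _*_; _^_; _∸_; _/_; _≤_; z≤n; s≤s; NonZero) renaming (_≟_ to _≟ℕ_)
open import Data.Nat.DivMod using (m*n/n≡m)
open import Data.Nat.Properties using (+-assoc; +-comm; +-identityʳ; *-comm; *-assoc; *-zeroʳ; *-identityʳ; *-identityˡ; *-distribˡ-+; *-distribʳ-+; +-mono-≤; m+n∸n≡m; m+n≡0⇒n≡0; suc-injective; +-commutativeSemigroup)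
open import Data.Product using (∃-syntax; _×_; _,_; proj₁; proj₂)
open import Data.Sum using (_⊎_; inj₁; inj₂)
open import Data.Unit using (tt)
open import Data.Vec using ([]; _∷_; head; tail)
open import Data.Vec.Properties using (≡-dec)
open import Function.Base using (_∘′_)
open import Function.Bundles using (_⇔_; mk⇔; Equivalence)
open import Function.Definitions using (Bijective)
open import Function.Properties.Equivalence using () renaming (sym to ⇔-sym; trans to ⇔-trans)
open import Relation.Binary.Definitions using (DecidableEquality; tri<; tri≈; tri>)
open import Relation.Binary.PropositionalEquality
open import Relation.Nullary using (¬_; Dec; yes; no; does)
open import Relation.Nullary.Decidable using (from-yes; _→-dec_; dec-true; dec-false)

private variable
  A B : Set

⟦_⟧ : Bool → ℕ
⟦ b ⟧ = if b then 1 else 0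

∑ : List A → (A → ℕ) → ℕ
∑ [] f = 0
∑ (x ∷ xs) f = f x + ∑ xs f

count≡∑ : (xs : List A) (p : A → Bool) → count xs p ≡ ∑ xs (λ x → ⟦ p x ⟧)
count≡∑ [] p = refl
count≡∑ (x ∷ xs) p = cong (⟦ p x ⟧ +_) (count≡∑ xs p)

count-cong : (xs : List A) {p q : A → Bool} → (∀ x → p x ≡ q x) → count xs p ≡ count xs q
count-cong [] e = refl
count-cong (x ∷ xs) e = cong₂ (λ b n → (if b then 1 else 0) + n) (e x) (count-cong xs e)

∑-cong : (xs : List A) {f g : A → ℕ} → (∀ x → f x ≡ g x) → ∑ xs f ≡ ∑ xs g
∑-cong [] e = refl
∑-cong (x ∷ xs) e = cong₂ _+_ (e x) (∑-cong xs e)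

∑-distrib-+ : (xs : List A) (f g : A → ℕ) → ∑ xs (λ x → f x + g x) ≡ ∑ xs f + ∑ xs g
∑-distrib-+ [] f g = refl
∑-distrib-+ (x ∷ xs) f g =
  trans (cong (f x + g x +_) (∑-distrib-+ xs f g))
        (interchange +-commutativeSemigroup (f x) (g x) (∑ xs f) (∑ xs g))

∑-*ˡ : (xs : List A) (c : ℕ) (f : A → ℕ) → ∑ xs (λ x → c * f x) ≡ c * ∑ xs f
∑-*ˡ [] c f = sym (*-zeroʳ c)
∑-*ˡ (x ∷ xs) c f = trans (cong (c * f x +_) (∑-*ˡ xs c f)) (sym (*-distribˡ-+ c (f x) (∑ xs f)))

∑-*ʳ : (xs : List A) (c : ℕ) (f : A → ℕ) → ∑ xs (λ x → f x * c) ≡ ∑ xs f * c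
∑-*ʳ xs c f = trans (∑-cong xs (λ x → *-comm (f x) c)) (trans (∑-*ˡ xs c f) (*-comm c _))

∑-zero : (xs : List A) → ∑ xs (λ _ → 0) ≡ 0
∑-zero [] = refl
∑-zero (x ∷ xs) = ∑-zero xs

∑-++ : (xs ys : List A) (f : A → ℕ) → ∑ (xs ++ ys) f ≡ ∑ xs f + ∑ ys f
∑-++ [] ys f = refl
∑-++ (x ∷ xs) ys f = trans (cong (f x +_) (∑-++ xs ys f)) (sym (+-assoc (f x) _ _))

∑-comm : (xs : List A) (ys : List B) (f : A → B → ℕ) →
  ∑ xs (λ x → ∑ ys (f x)) ≡ ∑ ys (λ y → ∑ xs (λ x → f x y))
∑-comm [] ys f = sym (∑-zero ys)
∑-comm (x ∷ xs) ys f =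
  trans (cong (∑ ys (f x) +_) (∑-comm xs ys f)) (sym (∑-distrib-+ ys (f x) _))

∑-map : (g : A → B) (xs : List A) (f : B → ℕ) → ∑ (lmap g xs) f ≡ ∑ xs (λ x → f (g x))
∑-map g [] f = refl
∑-map g (x ∷ xs) f = cong (f (g x) +_) (∑-map g xs f)

∑-concatMap : (g : A → List B) (xs : List A) (f : B → ℕ) →
  ∑ (concatMap g xs) f ≡ ∑ xs (λ x → ∑ (g x) f)
∑-concatMap g [] f = refl
∑-concatMap g (x ∷ xs) f = trans (∑-++ (g x) _ f) (cong (∑ (g x) f +_) (∑-concatMap g xs f))

∑-cartesianProduct : (xs : List A) (ys : List B) (f : A × B → ℕ) →
  ∑ (cartesianProduct xs ys) f ≡ ∑ xs (λ x → ∑ ys (λ y → f (x , y)))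
∑-cartesianProduct [] ys f = refl
∑-cartesianProduct (x ∷ xs) ys f =
  trans (∑-++ (lmap (x ,_) ys) _ f) (cong₂ _+_ (∑-map (x ,_) ys f) (∑-cartesianProduct xs ys f))

∑-mono : (xs : List A) {f g : A → ℕ} → (∀ x → f x ≤ g x) → ∑ xs f ≤ ∑ xs g
∑-mono [] h = z≤n
∑-mono (x ∷ xs) h = +-mono-≤ (h x) (∑-mono xs h)

∑≢0⇒witness : (xs : List A) (q : A → Bool) → ¬ ∑ xs (λ x → ⟦ q x ⟧) ≡ 0 → ∃[ x ] T (q x)
∑≢0⇒witness [] q ne = ⊥-elim (ne refl)
∑≢0⇒witness (x ∷ xs) q ne with q x in eq
... | true = x , subst T (sym eq) tt
... | false = ∑≢0⇒witness xs q ne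

does-cong : {P Q : Set} → (P → Q) → (Q → P) → (p : Dec P) (q : Dec Q) → does p ≡ does q
does-cong f g (yes p) (yes q) = refl
does-cong f g (yes p) (no ¬q) = ⊥-elim (¬q (f p))
does-cong f g (no ¬p) (yes q) = ⊥-elim (¬p (g q))
does-cong f g (no ¬p) (no ¬q) = refl

does-sym : (_≟_ : DecidableEquality A) (x y : A) → does (x ≟ y) ≡ does (y ≟ x)
does-sym _≟_ x y = does-cong sym sym (x ≟ y) (y ≟ x)

T-does : {P : Set} (p : Dec P) → T (does p) → P
T-does (yes p) _ = p

does-T : {P : Set} (p : Dec P) → P → T (does p)
does-T (yes p) _ = tt
does-T (no ¬p) x = ¬p x

transport-does : {P Q : Set} (p : Dec P) (q : Dec Q) → does p ≡ does q → Q → P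
transport-does p q e y = T-does p (subst T (sym e) (does-T q y))

⟦∧⟧ : (a b : Bool) → ⟦ a ∧ b ⟧ ≡ ⟦ a ⟧ * ⟦ b ⟧
⟦∧⟧ true true = refl
⟦∧⟧ true false = refl
⟦∧⟧ false b = refl

⟦∨⟧ : (a b : Bool) → (T a → ¬ T b) → ⟦ a ∨ b ⟧ ≡ ⟦ a ⟧ + ⟦ b ⟧
⟦∨⟧ true true exclusive = ⊥-elim (exclusive tt tt)
⟦∨⟧ true false _ = refl
⟦∨⟧ false b _ = refl

⟦not-b⟧+⟦b⟧≡1 : (a : Bool) → ⟦ not a ⟧ + ⟦ a ⟧ ≡ 1
⟦not-b⟧+⟦b⟧≡1 true = refl
⟦not-b⟧+⟦b⟧≡1 false = refl

module Enumeration {A : Set} (_≟_ : DecidableEquality A) (xs : List A)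
                   (each-once : ∀ a → ∑ xs (λ x → ⟦ does (x ≟ a) ⟧) ≡ 1) where

  δ : A → A → ℕ
  δ a b = ⟦ does (a ≟ b) ⟧

  δ-sym : ∀ a b → δ a b ≡ δ b a
  δ-sym a b = cong ⟦_⟧ (does-sym _≟_ a b)

  each-once′ : ∀ a → ∑ xs (δ a) ≡ 1
  each-once′ a = trans (∑-cong xs (δ-sym a)) (each-once a)

  ∑-δ : ∀ a (f : A → ℕ) → ∑ xs (λ x → δ x a * f x) ≡ f a
  ∑-δ a f = begin
    ∑ xs (λ x → δ x a * f x) ≡⟨ ∑-cong xs pointwise ⟩
    ∑ xs (λ x → δ x a * f a) ≡⟨ ∑-*ʳ xs (f a) (λ x → δ x a) ⟩
    ∑ xs (λ x → δ x a) * f a ≡⟨ cong (_* f a) (each-once a) ⟩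
    f a + 0                  ≡⟨ +-identityʳ (f a) ⟩
    f a                      ∎
    where
    open ≡-Reasoning
    pointwise : ∀ x → δ x a * f x ≡ δ x a * f a
    pointwise x with x ≟ a
    ... | yes refl = refl
    ... | no _ = refl

  ∑-δ′ : ∀ a (f : A → ℕ) → ∑ xs (λ x → δ a x * f x) ≡ f a
  ∑-δ′ a f = trans (∑-cong xs (λ x → cong (_* f x) (δ-sym a x))) (∑-δ a f)

  ∑-unique : (q : A → Bool) (a : A) → (∀ x → T (q x) → x ≡ a) → T (q a) →
    ∑ xs (λ x → ⟦ q x ⟧) ≡ 1
  ∑-unique q a only-a qa = trans (∑-cong xs q≡δ) (each-once a)
    where
    q≡δ : ∀ x → ⟦ q x ⟧ ≡ δ x a
    q≡δ x with q x in eq | x ≟ a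
    ... | true | yes _ = refl
    ... | true | no x≢a = ⊥-elim (x≢a (only-a x (subst T (sym eq) tt)))
    ... | false | yes refl = ⊥-elim (subst T eq qa)
    ... | false | no _ = refl

  ∑≡0⇒false : (q : A → Bool) → ∑ xs (λ x → ⟦ q x ⟧) ≡ 0 → ∀ a → q a ≡ false
  ∑≡0⇒false q ∑≡0 a = ≤0 (q a) (subst (⟦ q a ⟧ ≤_) ∑≡0
    (subst (_≤ ∑ xs (λ x → ⟦ q x ⟧)) (∑-δ a (λ x → ⟦ q x ⟧)) (∑-mono xs (λ x → δ*≤ (does (x ≟ a)) (q x)))))
    where
    ≤0 : ∀ b → ⟦ b ⟧ ≤ 0 → b ≡ false
    ≤0 false _ = refl
    δ*≤ : ∀ b c → ⟦ b ⟧ * ⟦ c ⟧ ≤ ⟦ c ⟧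
    δ*≤ true true = s≤s z≤n
    δ*≤ true false = z≤n
    δ*≤ false c = z≤n

  all-false-or-witness : (q : A → Bool) → (∀ a → q a ≡ false) ⊎ ∃[ x ] T (q x)
  all-false-or-witness q with ∑ xs (λ x → ⟦ q x ⟧) ≟ℕ 0
  ... | yes ∑≡0 = inj₁ (∑≡0⇒false q ∑≡0)
  ... | no ∑≢0 = inj₂ (∑≢0⇒witness xs q ∑≢0)

  ∑-reindex : (g h : A → A) → (∀ x → g (h x) ≡ x) → (∀ x → h (g x) ≡ x) → (f : A → ℕ) →
    ∑ xs (λ x → f (g x)) ≡ ∑ xs f
  ∑-reindex g h gh hg f = begin
    ∑ xs (λ x → f (g x))                          ≡⟨ ∑-cong xs (λ x → sym (∑-δ (g x) f)) ⟩
    ∑ xs (λ x → ∑ xs (λ y → δ y (g x) * f y))     ≡⟨ ∑-comm xs xs _ ⟩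
    ∑ xs (λ y → ∑ xs (λ x → δ y (g x) * f y))     ≡⟨ ∑-cong xs (λ y → ∑-*ʳ xs (f y) _) ⟩
    ∑ xs (λ y → ∑ xs (λ x → δ y (g x)) * f y)     ≡⟨ ∑-cong xs (λ y → cong (_* f y) (preimage-once y)) ⟩
    ∑ xs (λ y → 1 * f y)                          ≡⟨ ∑-cong xs (λ y → *-identityˡ (f y)) ⟩
    ∑ xs f                                        ∎
    where
    open ≡-Reasoning
    preimage-once : ∀ y → ∑ xs (λ x → δ y (g x)) ≡ 1
    preimage-once y = trans (∑-cong xs (λ x → cong ⟦_⟧
      (does-cong (λ e → trans (sym (hg x)) (cong h (sym e))) (λ e → trans (sym (gh y)) (cong g (sym e)))
                 (y ≟ g x) (x ≟ h y))))
      (each-once (h y))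

  ∑-except : ∀ a (f : A → ℕ) → ∑ xs (λ x → ⟦ not (does (a ≟ x)) ⟧ * f x) + f a ≡ ∑ xs f
  ∑-except a f = begin
    ∑ xs (λ x → ⟦ not (does (a ≟ x)) ⟧ * f x) + f a
      ≡⟨ cong (∑ xs (λ x → ⟦ not (does (a ≟ x)) ⟧ * f x) +_) (sym (∑-δ′ a f)) ⟩
    ∑ xs (λ x → ⟦ not (does (a ≟ x)) ⟧ * f x) + ∑ xs (λ x → δ a x * f x)
      ≡⟨ sym (∑-distrib-+ xs _ _) ⟩
    ∑ xs (λ x → ⟦ not (does (a ≟ x)) ⟧ * f x + δ a x * f x)
      ≡⟨ ∑-cong xs (λ x → trans (sym (*-distribʳ-+ (f x) ⟦ not (does (a ≟ x)) ⟧ (δ a x)))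
                                (trans (cong (_* f x) (⟦not-b⟧+⟦b⟧≡1 (does (a ≟ x)))) (*-identityˡ (f x)))) ⟩
    ∑ xs f ∎
    where open ≡-Reasoning

  ∑-except-two : ∀ a b →
    ∑ xs (λ x → ⟦ not (does (a ≟ x)) ⟧ * ⟦ not (does (x ≟ b)) ⟧) + 2 ≡ ∑ xs (λ _ → 1) + δ a b
  ∑-except-two a b = begin
    ∑ xs E + 2                                                ≡⟨ cong (∑ xs E +_) (sym (cong₂ _+_ (each-once′ a) (each-once b))) ⟩
    ∑ xs E + (∑ xs (δ a) + ∑ xs (λ x → δ x b))                ≡⟨ cong (∑ xs E +_) (sym (∑-distrib-+ xs _ _)) ⟩
    ∑ xs E + ∑ xs (λ x → δ a x + δ x b)                       ≡⟨ sym (∑-distrib-+ xs _ _) ⟩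
    ∑ xs (λ x → E x + (δ a x + δ x b))                        ≡⟨ ∑-cong xs (λ x → inclusion-exclusion (does (a ≟ x)) (does (x ≟ b))) ⟩
    ∑ xs (λ x → 1 + δ a x * δ x b)                            ≡⟨ ∑-distrib-+ xs _ _ ⟩
    ∑ xs (λ _ → 1) + ∑ xs (λ x → δ a x * δ x b)               ≡⟨ cong (∑ xs (λ _ → 1) +_) (∑-δ′ a (λ x → δ x b)) ⟩
    ∑ xs (λ _ → 1) + δ a b                                    ∎
    where
    open ≡-Reasoning
    E : A → ℕ
    E x = ⟦ not (does (a ≟ x)) ⟧ * ⟦ not (does (x ≟ b)) ⟧
    inclusion-exclusion : ∀ p q → ⟦ not p ⟧ * ⟦ not q ⟧ + (⟦ p ⟧ + ⟦ q ⟧) ≡ 1 + ⟦ p ⟧ * ⟦ q ⟧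
    inclusion-exclusion true true = refl
    inclusion-exclusion true false = refl
    inclusion-exclusion false true = refl
    inclusion-exclusion false false = refl

pattern 0F = fzero
pattern 1F = fsuc fzero
pattern 2F = fsuc (fsuc fzero)

-₃_ : Fin 3 → Fin 3
-₃ x = 2F *₃ x

+₃-identityˡ : ∀ x → 0F +₃ x ≡ x
+₃-identityˡ = from-yes (all? λ x → 0F +₃ x ≟F x)

+₃-identityʳ : ∀ x → x +₃ 0F ≡ x
+₃-identityʳ = from-yes (all? λ x → x +₃ 0F ≟F x)

*₃-zeroˡ : ∀ x → 0F *₃ x ≡ 0F
*₃-zeroˡ = from-yes (all? λ x → 0F *₃ x ≟F 0F)

*₃-zeroʳ : ∀ x → x *₃ 0F ≡ 0F
*₃-zeroʳ = from-yes (all? λ x → x *₃ 0F ≟F 0F)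

*₃-identityʳ : ∀ x → x *₃ 1F ≡ x
*₃-identityʳ = from-yes (all? λ x → x *₃ 1F ≟F x)

*₃-comm : ∀ x y → x *₃ y ≡ y *₃ x
*₃-comm = from-yes (all? λ x → all? λ y → x *₃ y ≟F y *₃ x)

+₃-inverseʳ : ∀ x a → (x +₃ a) +₃ (-₃ a) ≡ x
+₃-inverseʳ = from-yes (all? λ x → all? λ a → (x +₃ a) +₃ (-₃ a) ≟F x)

+₃-inverseˡ : ∀ x a → (x +₃ (-₃ a)) +₃ a ≡ x
+₃-inverseˡ = from-yes (all? λ x → all? λ a → (x +₃ (-₃ a)) +₃ a ≟F x)

x+-x≡0 : ∀ x → x +₃ (-₃ x) ≡ 0F
x+-x≡0 = from-yes (all? λ x → x +₃ (-₃ x) ≟F 0F)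

≟-via-difference : ∀ a b → does (a ≟F b) ≡ does ((a +₃ (-₃ b)) ≟F 0F)
≟-via-difference = from-yes (all? λ a → all? λ b → does (a ≟F b) ≟B does ((a +₃ (-₃ b)) ≟F 0F))

+₃-transpose : ∀ x t c → does ((x +₃ t) ≟F c) ≡ does (x ≟F (c +₃ (-₃ t)))
+₃-transpose = from-yes (all? λ x → all? λ t → all? λ c →
  does ((x +₃ t) ≟F c) ≟B does (x ≟F (c +₃ (-₃ t))))

-x≟0 : ∀ x → does ((-₃ x) ≟F 0F) ≡ does (x ≟F 0F)
-x≟0 = from-yes (all? λ x → does ((-₃ x) ≟F 0F) ≟B does (x ≟F 0F))

x≟-x : ∀ x → does (x ≟F (-₃ x)) ≡ does (x ≟F 0F)
x≟-x = from-yes (all? λ x → does (x ≟F (-₃ x)) ≟B does (x ≟F 0F))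

-₃-distribˡ-*₃ : ∀ x y → (-₃ x) *₃ y ≡ -₃ (x *₃ y)
-₃-distribˡ-*₃ = from-yes (all? λ x → all? λ y → (-₃ x) *₃ y ≟F -₃ (x *₃ y))

constant-on-ℤ₃ : (Q : Fin 3 → ℕ) → (∀ c → Q (c +₃ 2F) ≡ Q c) → ∀ c → Q c ≡ Q 0F
constant-on-ℤ₃ Q shift 0F = refl
constant-on-ℤ₃ Q shift 1F = trans (shift 2F) (shift 0F)
constant-on-ℤ₃ Q shift 2F = shift 0F

square-nonzero : ∀ x → ¬ x ≡ 0F → x *₃ x ≡ 1F
square-nonzero 0F x≢0 = ⊥-elim (x≢0 refl)
square-nonzero 1F _ = refl
square-nonzero 2F _ = refl

*₃-distrib-+₃-interchange : ∀ y u v a b →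
  (y *₃ (u +₃ v)) +₃ (a +₃ b) ≡ ((y *₃ u) +₃ a) +₃ ((y *₃ v) +₃ b)
*₃-distrib-+₃-interchange = from-yes (all? λ y → all? λ u → all? λ v → all? λ a → all? λ b →
  (y *₃ (u +₃ v)) +₃ (a +₃ b) ≟F ((y *₃ u) +₃ a) +₃ ((y *₃ v) +₃ b))

*₃-distrib-+₃-scale : ∀ y c v b → (y *₃ (c *₃ v)) +₃ (c *₃ b) ≡ c *₃ ((y *₃ v) +₃ b)
*₃-distrib-+₃-scale = from-yes (all? λ y → all? λ c → all? λ v → all? λ b →
  (y *₃ (c *₃ v)) +₃ (c *₃ b) ≟F c *₃ ((y *₃ v) +₃ b))

infix 4 _≟V_
_≟V_ : {d : ℕ} → DecidableEquality (V d)
_≟V_ = ≡-dec _≟F_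

0V : {d : ℕ} → V d
0V {zero} = []
0V {suc d} = 0F ∷ 0V

-V_ : {d : ℕ} → V d → V d
-V v = 2F ·V v

+V-inverseʳ : {d : ℕ} (v a : V d) → (v +V a) +V (-V a) ≡ v
+V-inverseʳ [] [] = refl
+V-inverseʳ (x ∷ v) (a ∷ as) = cong₂ _∷_ (+₃-inverseʳ x a) (+V-inverseʳ v as)

+V-inverseˡ : {d : ℕ} (v a : V d) → (v +V (-V a)) +V a ≡ v
+V-inverseˡ [] [] = refl
+V-inverseˡ (x ∷ v) (a ∷ as) = cong₂ _∷_ (+₃-inverseˡ x a) (+V-inverseˡ v as)

+V-identityˡ : {d : ℕ} (v : V d) → 0V +V v ≡ v
+V-identityˡ [] = refl
+V-identityˡ (x ∷ v) = cong₂ _∷_ (+₃-identityˡ x) (+V-identityˡ v)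

·V-zeroʳ : {d : ℕ} (c : Fin 3) → c ·V 0V {d} ≡ 0V
·V-zeroʳ {zero} c = refl
·V-zeroʳ {suc d} c = cong₂ _∷_ (*₃-zeroʳ c) (·V-zeroʳ c)

difference≡0⇒≡ : {d : ℕ} (u v : V d) → u +V (-V v) ≡ 0V → u ≡ v
difference≡0⇒≡ [] [] e = refl
difference≡0⇒≡ (x ∷ u) (y ∷ v) e =
  cong₂ _∷_ (transport-does (x ≟F y) (_ ≟F 0F) (≟-via-difference x y) (cong head e))
            (difference≡0⇒≡ u v (cong tail e))

-V≡0⇒≡0 : {d : ℕ} (v : V d) → -V v ≡ 0V → v ≡ 0V
-V≡0⇒≡0 [] e = refl
-V≡0⇒≡0 (x ∷ v) e =
  cong₂ _∷_ (transport-does (x ≟F 0F) (_ ≟F 0F) (sym (-x≟0 x)) (cong head e)) (-V≡0⇒≡0 v (cong tail e))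

≡-V⇒≡0 : {d : ℕ} (v : V d) → v ≡ -V v → v ≡ 0V
≡-V⇒≡0 [] e = refl
≡-V⇒≡0 (x ∷ v) e =
  cong₂ _∷_ (transport-does (x ≟F 0F) (x ≟F (-₃ x)) (sym (x≟-x x)) (cong head e)) (≡-V⇒≡0 v (cong tail e))

∑-allFin-tabulate : ∀ {m} (h : Fin m → A) (g : A → ℕ) → ∑ (tabulate h) g ≡ ∑ (allFin m) (λ x → g (h x))
∑-allFin-tabulate {m = zero} h g = refl
∑-allFin-tabulate {m = suc m} h g =
  cong (g (h fzero) +_) (trans (∑-allFin-tabulate (λ x → h (fsuc x)) g) (sym (∑-allFin-tabulate fsuc (λ x → g (h x)))))

∑-allFin-suc : ∀ n (g : Fin (suc n) → ℕ) → ∑ (allFin (suc n)) g ≡ g fzero + ∑ (allFin n) (λ x → g (fsuc x))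
∑-allFin-suc n g = cong (g fzero +_) (∑-allFin-tabulate fsuc g)

allFin-each-once : ∀ {n} (a : Fin n) → ∑ (allFin n) (λ x → ⟦ does (x ≟F a) ⟧) ≡ 1
allFin-each-once {suc n} fzero = trans (∑-allFin-suc n (λ x → ⟦ does (x ≟F fzero) ⟧)) (cong suc (∑-zero (allFin n)))
allFin-each-once {suc n} (fsuc a) = trans (∑-allFin-suc n (λ x → ⟦ does (x ≟F fsuc a) ⟧)) (allFin-each-once a)

∑-allFin-1 : ∀ n → ∑ (allFin n) (λ _ → 1) ≡ n
∑-allFin-1 zero = refl
∑-allFin-1 (suc n) = trans (∑-allFin-suc n (λ _ → 1)) (cong suc (∑-allFin-1 n))

∑-allV-suc : ∀ d (f : V (suc d) → ℕ) → ∑ (allV (suc d)) f ≡ ∑ (allFin 3) (λ x → ∑ (allV d) (λ v → f (x ∷ v)))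
∑-allV-suc d f = trans (∑-concatMap (λ x → lmap (x ∷_) (allV d)) (allFin 3) f)
                       (∑-cong (allFin 3) (λ x → ∑-map (x ∷_) (allV d) f))

allV-each-once : ∀ {d} (a : V d) → ∑ (allV d) (λ x → ⟦ does (x ≟V a) ⟧) ≡ 1
allV-each-once {zero} [] = refl
allV-each-once {suc d} (a ∷ as) = begin
  ∑ (allV (suc d)) (λ x → ⟦ does (x ≟V (a ∷ as)) ⟧)
    ≡⟨ ∑-allV-suc d (λ x → ⟦ does (x ≟V (a ∷ as)) ⟧) ⟩
  ∑ (allFin 3) (λ x → ∑ (allV d) (λ v → ⟦ does (x ≟F a) ∧ does (v ≟V as) ⟧))
    ≡⟨ ∑-cong (allFin 3) (λ x → ∑-cong (allV d) (λ v → ⟦∧⟧ (does (x ≟F a)) (does (v ≟V as)))) ⟩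
  ∑ (allFin 3) (λ x → ∑ (allV d) (λ v → ⟦ does (x ≟F a) ⟧ * ⟦ does (v ≟V as) ⟧))
    ≡⟨ ∑-cong (allFin 3) (λ x → trans (∑-*ˡ (allV d) ⟦ does (x ≟F a) ⟧ (λ v → ⟦ does (v ≟V as) ⟧))
                                       (trans (cong (⟦ does (x ≟F a) ⟧ *_) (allV-each-once as))
                                              (*-identityʳ ⟦ does (x ≟F a) ⟧))) ⟩
  ∑ (allFin 3) (λ x → ⟦ does (x ≟F a) ⟧)
    ≡⟨ allFin-each-once a ⟩
  1 ∎
  where open ≡-Reasoning

∑-allV-1 : ∀ d → ∑ (allV d) (λ _ → 1) ≡ 3 ^ d
∑-allV-1 zero = refl
∑-allV-1 (suc d) = trans (∑-allV-suc d (λ _ → 1)) (∑-cong (allFin 3) (λ _ → ∑-allV-1 d))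

module EF {n : ℕ} = Enumeration (_≟F_ {n}) (allFin n) allFin-each-once
module EV {d : ℕ} = Enumeration (_≟V_ {d}) (allV d) allV-each-once

module _ {d : ℕ} where

  fibre : (V d → Fin 3) → Fin 3 → ℕ
  fibre f c = ∑ (allV d) (λ v → ⟦ does (f v ≟F c) ⟧)

  jointFibre : (V d → Fin 3) → (V d → Fin 3) → Fin 3 → Fin 3 → ℕ
  jointFibre f g c c′ = ∑ (allV d) (λ v → ⟦ does (f v ≟F c) ⟧ * ⟦ does (g v ≟F c′) ⟧)

  ∑-translate : (a : V d) (P : V d → ℕ) → ∑ (allV d) (λ v → P (v +V a)) ≡ ∑ (allV d) P
  ∑-translate a = EV.∑-reindex (_+V a) (_+V (-V a)) (λ v → +V-inverseˡ v a) (λ v → +V-inverseʳ v a)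

  linear-translate : {f : V d → Fin 3} {a : V d} {t : Fin 3} → IsLinear f → f a ≡ t →
    ∀ v c → does (f (v +V a) ≟F c) ≡ does (f v ≟F (c +₃ (-₃ t)))
  linear-translate {f} {a} {t} (f-+ , _) fa≡t v c =
    trans (cong (λ z → does (z ≟F c)) (trans (f-+ v a) (cong (f v +₃_) fa≡t))) (+₃-transpose (f v) t c)

  fibre-size : (f : V d → Fin 3) → IsLinear f → IsSurjective f → ∀ c → 3 * fibre f c ≡ 3 ^ d
  fibre-size f lin surj c = begin
    3 * fibre f c                                             ≡⟨ cong (3 *_) (same-size c) ⟩
    ∑ (allFin 3) (λ _ → fibre f 0F)                           ≡⟨ ∑-cong (allFin 3) (λ c → sym (same-size c)) ⟩
    ∑ (allFin 3) (fibre f)                                    ≡⟨ ∑-comm (allFin 3) (allV d) (λ c v → ⟦ does (f v ≟F c) ⟧) ⟩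
    ∑ (allV d) (λ v → ∑ (allFin 3) (λ c → ⟦ does (f v ≟F c) ⟧)) ≡⟨ ∑-cong (allV d) (λ v → EF.each-once′ (f v)) ⟩
    ∑ (allV d) (λ _ → 1)                                      ≡⟨ ∑-allV-1 d ⟩
    3 ^ d                                                     ∎
    where
    open ≡-Reasoning
    a : V d
    a = proj₁ (surj 1F)
    same-size : ∀ c → fibre f c ≡ fibre f 0F
    same-size = constant-on-ℤ₃ (fibre f) λ c →
      trans (∑-cong (allV d) (λ v → cong ⟦_⟧ (sym (linear-translate lin (proj₂ (surj 1F)) v c))))
            (∑-translate a (λ v → ⟦ does (f v ≟F c) ⟧))

  joint-fibre-size : (f g : V d → Fin 3) → IsLinear f → IsLinear g → (a b : V d) →
    f a ≡ 1F → g a ≡ 0F → f b ≡ 0F → g b ≡ 1F → ∀ c c′ → 9 * jointFibre f g c c′ ≡ 3 ^ d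
  joint-fibre-size f g f-lin g-lin a b fa ga fb gb c c′ = begin
    9 * Φ c c′                                                ≡⟨ cong (9 *_) (same-size c c′) ⟩
    9 * Φ 0F 0F                                               ≡⟨ *-assoc 3 3 (Φ 0F 0F) ⟩
    ∑ (allFin 3) (λ _ → ∑ (allFin 3) (λ _ → Φ 0F 0F))         ≡⟨ ∑-cong (allFin 3) (λ c → ∑-cong (allFin 3) (λ c′ → sym (same-size c c′))) ⟩
    ∑ (allFin 3) (λ c → ∑ (allFin 3) (Φ c))                   ≡⟨ ∑-cong (allFin 3) (λ c → ∑-comm (allFin 3) (allV d) (λ c′ v → ⟦ does (f v ≟F c) ⟧ * ⟦ does (g v ≟F c′) ⟧)) ⟩
    ∑ (allFin 3) (λ c → ∑ (allV d) (λ v → ∑ (allFin 3) (λ c′ → ⟦ does (f v ≟F c) ⟧ * ⟦ does (g v ≟F c′) ⟧)))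
      ≡⟨ ∑-comm (allFin 3) (allV d) (λ c v → ∑ (allFin 3) (λ c′ → ⟦ does (f v ≟F c) ⟧ * ⟦ does (g v ≟F c′) ⟧)) ⟩
    ∑ (allV d) (λ v → ∑ (allFin 3) (λ c → ∑ (allFin 3) (λ c′ → ⟦ does (f v ≟F c) ⟧ * ⟦ does (g v ≟F c′) ⟧)))
      ≡⟨ ∑-cong (allV d) one-cell ⟩
    ∑ (allV d) (λ _ → 1)                                      ≡⟨ ∑-allV-1 d ⟩
    3 ^ d                                                     ∎
    where
    open ≡-Reasoning
    Φ : Fin 3 → Fin 3 → ℕ
    Φ = jointFibre f g
    translate : ∀ {x t s} → f x ≡ t → g x ≡ s → ∀ c c′ → Φ (c +₃ (-₃ t)) (c′ +₃ (-₃ s)) ≡ Φ c c′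
    translate {x} fx gx c c′ =
      trans (∑-cong (allV d) (λ v → sym (cong₂ (λ p q → ⟦ p ⟧ * ⟦ q ⟧)
                                     (linear-translate f-lin fx v c) (linear-translate g-lin gx v c′))))
            (∑-translate x (λ v → ⟦ does (f v ≟F c) ⟧ * ⟦ does (g v ≟F c′) ⟧))
    same-size : ∀ c c′ → Φ c c′ ≡ Φ 0F 0F
    same-size c c′ = trans
      (constant-on-ℤ₃ (λ z → Φ z c′) (λ z → trans (cong (Φ (z +₃ 2F)) (sym (+₃-identityʳ c′))) (translate fa ga z c′)) c)
      (constant-on-ℤ₃ (Φ 0F) (λ z → translate fb gb 0F z) c′)
    one-cell : ∀ v → ∑ (allFin 3) (λ c → ∑ (allFin 3) (λ c′ → ⟦ does (f v ≟F c) ⟧ * ⟦ does (g v ≟F c′) ⟧)) ≡ 1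
    one-cell v = trans (∑-cong (allFin 3) (λ c →
                   trans (∑-*ˡ (allFin 3) ⟦ does (f v ≟F c) ⟧ (λ c′ → ⟦ does (g v ≟F c′) ⟧))
                         (trans (cong (⟦ does (f v ≟F c) ⟧ *_) (EF.each-once′ (g v))) (*-identityʳ ⟦ does (f v ≟F c) ⟧))))
                 (EF.each-once′ (f v))

  normalise-in-kernel : {f g : V d → Fin 3} → IsLinear f → IsLinear g → (x : V d) →
    f x ≡ 0F → ¬ g x ≡ 0F → ∃[ b ] (f b ≡ 0F × g b ≡ 1F)
  normalise-in-kernel {f} {g} (_ , f-·) (_ , g-·) x fx≡0 gx≢0 =
    g x ·V x ,
    trans (f-· (g x) x) (trans (cong (g x *₃_) fx≡0) (*₃-zeroʳ (g x))) ,
    trans (g-· (g x) x) (square-nonzero (g x) gx≢0)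

  complement-in-kernel : {f g : V d → Fin 3} → IsLinear f → IsLinear g → IsSurjective f → (b : V d) →
    f b ≡ 0F → g b ≡ 1F → ∃[ a ] (f a ≡ 1F × g a ≡ 0F)
  complement-in-kernel {f} {g} (f-+ , f-·) (g-+ , g-·) f-onto b fb≡0 gb≡1 = p +V (c ·V b) , fa≡1 , ga≡0
    where
    p : V d
    p = proj₁ (f-onto 1F)
    c : Fin 3
    c = -₃ g p
    fa≡1 : f (p +V (c ·V b)) ≡ 1F
    fa≡1 = begin
      f (p +V (c ·V b))  ≡⟨ f-+ p (c ·V b) ⟩
      f p +₃ f (c ·V b)  ≡⟨ cong₂ _+₃_ (proj₂ (f-onto 1F)) (trans (f-· c b) (cong (c *₃_) fb≡0)) ⟩
      1F +₃ (c *₃ 0F)    ≡⟨ cong (1F +₃_) (*₃-zeroʳ c) ⟩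
      1F                 ∎
      where open ≡-Reasoning
    ga≡0 : g (p +V (c ·V b)) ≡ 0F
    ga≡0 = begin
      g (p +V (c ·V b))  ≡⟨ g-+ p (c ·V b) ⟩
      g p +₃ g (c ·V b)  ≡⟨ cong (g p +₃_) (trans (g-· c b) (trans (cong (c *₃_) gb≡1) (*₃-identityʳ c))) ⟩
      g p +₃ c           ≡⟨ x+-x≡0 (g p) ⟩
      0F                 ∎
      where open ≡-Reasoning

  separating-vectors : (f g : V d → Fin 3) → IsLinear f → IsLinear g → IsSurjective f → IsSurjective g →
    ¬ SameKernel f g → ∃[ a ] ∃[ b ] (f a ≡ 1F × g a ≡ 0F × f b ≡ 0F × g b ≡ 1F)
  separating-vectors f g f-lin g-lin f-onto g-onto ker-f≢ker-g
    with EV.all-false-or-witness (λ v → does (f v ≟F 0F) xor does (g v ≟F 0F))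
  ... | inj₁ agree = ⊥-elim (ker-f≢ker-g (λ v → xor≡false⇒⇔ (f v ≟F 0F) (g v ≟F 0F) (agree v)))
    where
    xor≡false⇒⇔ : {P Q : Set} (p : Dec P) (q : Dec Q) → does p xor does q ≡ false → P ⇔ Q
    xor≡false⇒⇔ (yes p) (yes q) _ = mk⇔ (λ _ → q) (λ _ → p)
    xor≡false⇒⇔ (no ¬p) (no ¬q) _ = mk⇔ (λ p → ⊥-elim (¬p p)) (λ q → ⊥-elim (¬q q))
  ... | inj₂ (x , differ) with f x ≟F 0F | g x ≟F 0F
  ... | yes fx≡0 | no gx≢0 =
    let (b , fb , gb) = normalise-in-kernel f-lin g-lin x fx≡0 gx≢0
        (a , fa , ga) = complement-in-kernel f-lin g-lin f-onto b fb gb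
    in a , b , fa , ga , fb , gb
  ... | no fx≢0 | yes gx≡0 =
    let (a , ga , fa) = normalise-in-kernel g-lin f-lin x gx≡0 fx≢0
        (b , gb , fb) = complement-in-kernel g-lin f-lin g-onto a ga fa
    in a , b , fa , ga , fb , gb
  ... | yes _ | yes _ = ⊥-elim differ
  ... | no _ | no _ = ⊥-elim differ

_∙_ : {d : ℕ} → V d → V d → Fin 3
[] ∙ [] = 0F
(y ∷ ys) ∙ (x ∷ xs) = (y *₃ x) +₃ (ys ∙ xs)

∙-linearʳ : {d : ℕ} (y : V d) → IsLinear (y ∙_)
∙-linearʳ y = additive y , homogeneous y
  where
  additive : ∀ {d} (y u v : V d) → y ∙ (u +V v) ≡ (y ∙ u) +₃ (y ∙ v)
  additive [] [] [] = refl
  additive (y ∷ ys) (u ∷ us) (v ∷ vs) =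
    trans (cong ((y *₃ (u +₃ v)) +₃_) (additive ys us vs)) (*₃-distrib-+₃-interchange y u v _ _)
  homogeneous : ∀ {d} (y : V d) (c : Fin 3) (v : V d) → y ∙ (c ·V v) ≡ c *₃ (y ∙ v)
  homogeneous [] c [] = sym (*₃-zeroʳ c)
  homogeneous (y ∷ ys) c (v ∷ vs) =
    trans (cong ((y *₃ (c *₃ v)) +₃_) (homogeneous ys c vs)) (*₃-distrib-+₃-scale y c v _)

∙-comm : {d : ℕ} (y x : V d) → y ∙ x ≡ x ∙ y
∙-comm [] [] = refl
∙-comm (y ∷ ys) (x ∷ xs) = cong₂ _+₃_ (*₃-comm y x) (∙-comm ys xs)

0V-∙ : {d : ℕ} (x : V d) → 0V ∙ x ≡ 0F
0V-∙ [] = refl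
0V-∙ (x ∷ xs) = trans (cong ((0F *₃ x) +₃_) (0V-∙ xs)) (trans (+₃-identityʳ (0F *₃ x)) (*₃-zeroˡ x))

∙-0V : {d : ℕ} (x : V d) → x ∙ 0V ≡ 0F
∙-0V x = trans (∙-comm x 0V) (0V-∙ x)

∙-linearˡ : {d : ℕ} (x : V d) → IsLinear (_∙ x)
∙-linearˡ x =
  (λ u v → trans (∙-comm (u +V v) x) (trans (proj₁ (∙-linearʳ x) u v) (cong₂ _+₃_ (∙-comm x u) (∙-comm x v)))) ,
  (λ c v → trans (∙-comm (c ·V v) x) (trans (proj₂ (∙-linearʳ x) c v) (cong (c *₃_) (∙-comm x v))))

∙-reaches-1 : {d : ℕ} (x : V d) → ¬ x ≡ 0V → ∃[ y ] y ∙ x ≡ 1F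
∙-reaches-1 [] x≢0 = ⊥-elim (x≢0 refl)
∙-reaches-1 (x ∷ xs) x≢0 with x ≟F 0F
... | no x₀≢0 = x ∷ 0V ,
  trans (cong ((x *₃ x) +₃_) (0V-∙ xs)) (trans (+₃-identityʳ (x *₃ x)) (square-nonzero x x₀≢0))
... | yes refl with ∙-reaches-1 xs (λ xs≡0 → x≢0 (cong (0F ∷_) xs≡0))
...   | y , y∙xs≡1 = 0F ∷ y , trans (+₃-identityˡ (y ∙ xs)) y∙xs≡1

∙-surjectiveˡ : {d : ℕ} (x : V d) → ¬ x ≡ 0V → IsSurjective (_∙ x)
∙-surjectiveˡ x x≢0 c =
  let (y , y∙x≡1) = ∙-reaches-1 x x≢0
  in c ·V y , trans (proj₂ (∙-linearˡ x) c y) (trans (cong (c *₃_) y∙x≡1) (*₃-identityʳ c))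

∙-surjectiveʳ : {d : ℕ} (y : V d) → ¬ y ≡ 0V → IsSurjective (y ∙_)
∙-surjectiveʳ y y≢0 c = let (x , x∙y≡c) = ∙-surjectiveˡ y y≢0 c in x , trans (∙-comm y x) x∙y≡c

coefficients : {d : ℕ} → (V d → Fin 3) → V d
coefficients {zero} f = []
coefficients {suc d} f = f (1F ∷ 0V) ∷ coefficients (λ v → f (0F ∷ v))

coefficients-cong : {d : ℕ} {f g : V d → Fin 3} → (∀ v → f v ≡ g v) → coefficients f ≡ coefficients g
coefficients-cong {zero} e = refl
coefficients-cong {suc d} e = cong₂ _∷_ (e _) (coefficients-cong (λ v → e (0F ∷ v)))

coefficients-scale : {d : ℕ} (c : Fin 3) (f : V d → Fin 3) → coefficients (λ v → c *₃ f v) ≡ c ·V coefficients f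
coefficients-scale {zero} c f = refl
coefficients-scale {suc d} c f = cong (c *₃ f (1F ∷ 0V) ∷_) (coefficients-scale c (λ v → f (0F ∷ v)))

coefficients-∙ : {d : ℕ} (y : V d) → coefficients (y ∙_) ≡ y
coefficients-∙ [] = refl
coefficients-∙ (y ∷ ys) = cong₂ _∷_
  (trans (cong ((y *₃ 1F) +₃_) (∙-0V ys)) (trans (+₃-identityʳ (y *₃ 1F)) (*₃-identityʳ y)))
  (trans (coefficients-cong (λ v → trans (cong (_+₃ (ys ∙ v)) (*₃-zeroʳ y)) (+₃-identityˡ (ys ∙ v))))
         (coefficients-∙ ys))

linear⇒∙ : {d : ℕ} (f : V d → Fin 3) → IsLinear f → ∀ v → f v ≡ coefficients f ∙ v
linear⇒∙ {zero} f (_ , f-·) [] = trans (f-· 0F []) (*₃-zeroˡ (f []))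
linear⇒∙ {suc d} f (f-+ , f-·) (x ∷ v) = begin
  f (x ∷ v)                                  ≡⟨ cong f (sym split) ⟩
  f ((x ·V (1F ∷ 0V)) +V (0F ∷ v))           ≡⟨ f-+ _ _ ⟩
  f (x ·V (1F ∷ 0V)) +₃ f (0F ∷ v)           ≡⟨ cong₂ _+₃_ (f-· x _) (linear⇒∙ f₀ f₀-linear v) ⟩
  (x *₃ f (1F ∷ 0V)) +₃ (coefficients f₀ ∙ v) ≡⟨ cong (_+₃ (coefficients f₀ ∙ v)) (*₃-comm x _) ⟩
  coefficients f ∙ (x ∷ v)                   ∎
  where
  open ≡-Reasoning
  f₀ : V d → Fin 3
  f₀ v = f (0F ∷ v)
  split : (x ·V (1F ∷ 0V)) +V (0F ∷ v) ≡ x ∷ v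
  split = cong₂ _∷_ (trans (+₃-identityʳ (x *₃ 1F)) (*₃-identityʳ x)) (trans (cong (_+V v) (·V-zeroʳ x)) (+V-identityˡ v))
  f₀-linear : IsLinear f₀
  f₀-linear = (λ u w → f-+ (0F ∷ u) (0F ∷ w)) ,
              (λ c w → trans (cong (λ z → f (z ∷ (c ·V w))) (sym (*₃-zeroʳ c))) (f-· c (0F ∷ w)))

module _ {d : ℕ} where

  Proportional : (V d → Fin 3) → (V d → Fin 3) → Set
  Proportional f g = (∀ v → f v ≡ g v) ⊎ (∀ v → f v ≡ -₃ g v)

  same-kernel⇒factor : (f g : V d → Fin 3) → IsLinear f → IsLinear g → SameKernel f g →
    (a : V d) → g a ≡ 1F → ∀ v → f v ≡ g v *₃ f a
  same-kernel⇒factor f g (f-+ , f-·) (g-+ , g-·) same a ga≡1 v =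
    transport-does (f v ≟F (g v *₃ f a)) ((f v +₃ (-₃ (g v *₃ f a))) ≟F 0F)
      (≟-via-difference (f v) (g v *₃ f a))
      (trans (sym f[v-gv·a]) (Equivalence.from (same w) g[v-gv·a]))
    where
    w : V d
    w = v +V ((-₃ g v) ·V a)
    f[v-gv·a] : f w ≡ f v +₃ (-₃ (g v *₃ f a))
    f[v-gv·a] = trans (f-+ v _) (cong (f v +₃_) (trans (f-· (-₃ g v) a) (-₃-distribˡ-*₃ (g v) (f a))))
    g[v-gv·a] : g w ≡ 0F
    g[v-gv·a] = trans (g-+ v _)
      (trans (cong (g v +₃_) (trans (g-· (-₃ g v) a) (trans (cong ((-₃ g v) *₃_) ga≡1) (*₃-identityʳ (-₃ g v)))))
             (x+-x≡0 (g v)))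

  same-kernel⇒proportional : (f g : V d → Fin 3) → IsLinear f → IsLinear g → IsSurjective g →
    SameKernel f g → Proportional f g
  same-kernel⇒proportional f g f-lin g-lin g-onto same with g-onto 1F
  ... | a , ga≡1 = by-value (f a) refl
    where
    factor : ∀ v → f v ≡ g v *₃ f a
    factor = same-kernel⇒factor f g f-lin g-lin same a ga≡1
    by-value : ∀ c → f a ≡ c → Proportional f g
    by-value 0F fa≡0 with () ← trans (sym (Equivalence.to (same a) fa≡0)) ga≡1
    by-value 1F fa≡1 = inj₁ (λ v → trans (factor v) (trans (cong (g v *₃_) fa≡1) (*₃-identityʳ (g v))))
    by-value 2F fa≡2 = inj₂ (λ v → trans (factor v) (trans (cong (g v *₃_) fa≡2) (*₃-comm (g v) 2F)))

  proportional⇒same-kernel : (f g : V d → Fin 3) → Proportional f g → SameKernel f g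
  proportional⇒same-kernel f g (inj₁ f≡g) v = mk⇔ (trans (sym (f≡g v))) (trans (f≡g v))
  proportional⇒same-kernel f g (inj₂ f≡-g) v =
    mk⇔ (λ fv≡0 → transport-does (g v ≟F 0F) ((-₃ g v) ≟F 0F) (sym (-x≟0 (g v))) (trans (sym (f≡-g v)) fv≡0))
        (λ gv≡0 → trans (f≡-g v) (cong (2F *₃_) gv≡0))

  SameKernel-sym : {f g : V d → Fin 3} → SameKernel f g → SameKernel g f
  SameKernel-sym same v = ⇔-sym (same v)

  SameKernel-trans : {f g h : V d → Fin 3} → SameKernel f g → SameKernel g h → SameKernel f h
  SameKernel-trans fg gh v = ⇔-trans (fg v) (gh v)

module Hyperplanes {d r : ℕ} (π : Fin r → V d → Fin 3)
  (π-linear : ∀ h → IsLinear (π h)) (π-onto : ∀ h → IsSurjective (π h))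
  (π-distinct : ∀ h h′ → h ≢ h′ → ¬ SameKernel (π h) (π h′))
  (π-complete : ∀ (f : V d → Fin 3) → IsLinear f → IsSurjective f → ∃[ h ] SameKernel f (π h)) where

  normal : Fin r → V d
  normal h = coefficients (π h)

  π≡normal∙ : ∀ h v → π h v ≡ normal h ∙ v
  π≡normal∙ h = linear⇒∙ (π h) (π-linear h)

  normal≢0 : ∀ h → ¬ normal h ≡ 0V
  normal≢0 h normal≡0 with π-onto h 1F
  ... | v , πv≡1 with () ← trans (sym πv≡1) (trans (π≡normal∙ h v) (trans (cong (_∙ v) normal≡0) (0V-∙ v)))

  -normal≢0 : ∀ h → ¬ -V normal h ≡ 0V
  -normal≢0 h = normal≢0 h ∘′ -V≡0⇒≡0 (normal h)

  IsNormalOf : Fin r → V d → Bool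
  IsNormalOf h y = does (y ≟V normal h) ∨ does (y ≟V -V normal h)

  ⟦IsNormalOf⟧ : ∀ h y → ⟦ IsNormalOf h y ⟧ ≡ ⟦ does (y ≟V normal h) ⟧ + ⟦ does (y ≟V -V normal h) ⟧
  ⟦IsNormalOf⟧ h y = ⟦∨⟧ _ _ λ y≡n y≡-n → normal≢0 h
    (≡-V⇒≡0 (normal h) (trans (sym (T-does (y ≟V normal h) y≡n)) (T-does (y ≟V -V normal h) y≡-n)))

  nonzero-normal-of-one : ∀ y → ⟦ not (does (y ≟V 0V)) ⟧ ≡ ∑ (allFin r) (λ h → ⟦ IsNormalOf h y ⟧)
  nonzero-normal-of-one y with y ≟V 0V
  ... | yes refl = sym (trans (∑-cong (allFin r) (λ h → cong ⟦_⟧ (cong₂ _∨_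
          (dec-false (0V ≟V normal h) (normal≢0 h ∘′ sym)) (dec-false (0V ≟V -V normal h) (-normal≢0 h ∘′ sym)))))
        (∑-zero (allFin r)))
  ... | no y≢0 = sym (EF.∑-unique (λ h → IsNormalOf h y) h₀ only-h₀ y-normal-of-h₀)
    where
    h₀ : Fin r
    h₀ = proj₁ (π-complete (y ∙_) (∙-linearʳ y) (∙-surjectiveʳ y y≢0))
    ker-y≡ker-h₀ : SameKernel (y ∙_) (π h₀)
    ker-y≡ker-h₀ = proj₂ (π-complete (y ∙_) (∙-linearʳ y) (∙-surjectiveʳ y y≢0))
    y-normal-of-h₀ : T (IsNormalOf h₀ y)
    y-normal-of-h₀ with same-kernel⇒proportional (y ∙_) (π h₀) (∙-linearʳ y) (π-linear h₀) (π-onto h₀) ker-y≡ker-h₀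
    ... | inj₁ y∙≡π = Equivalence.from T-∨ (inj₁ (does-T (y ≟V normal h₀)
          (trans (sym (coefficients-∙ y)) (coefficients-cong y∙≡π))))
    ... | inj₂ y∙≡-π = Equivalence.from T-∨ (inj₂ (does-T (y ≟V -V normal h₀)
          (trans (sym (coefficients-∙ y)) (trans (coefficients-cong y∙≡-π) (coefficients-scale 2F (π h₀))))))
    proportional-to : ∀ h → T (IsNormalOf h y) → Proportional (y ∙_) (π h)
    proportional-to h y-normal with Equivalence.to T-∨ y-normal
    ... | inj₁ y≡n = inj₁ λ v → trans (cong (_∙ v) (T-does (y ≟V normal h) y≡n)) (sym (π≡normal∙ h v))
    ... | inj₂ y≡-n = inj₂ λ v → trans (cong (_∙ v) (T-does (y ≟V -V normal h) y≡-n))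
          (trans (proj₂ (∙-linearˡ v) 2F (normal h)) (cong (2F *₃_) (sym (π≡normal∙ h v))))
    only-h₀ : ∀ h → T (IsNormalOf h y) → h ≡ h₀
    only-h₀ h y-normal with h ≟F h₀
    ... | yes h≡h₀ = h≡h₀
    ... | no h≢h₀ = ⊥-elim (π-distinct h h₀ h≢h₀ (SameKernel-trans
          (SameKernel-sym (proportional⇒same-kernel (y ∙_) (π h) (proportional-to h y-normal))) ker-y≡ker-h₀))

  kernels∋ : V d → ℕ
  kernels∋ x = ∑ (allFin r) (λ h → ⟦ does (π h x ≟F 0F) ⟧)

  normals-annihilate : ∀ x h →
    ∑ (allV d) (λ y → ⟦ IsNormalOf h y ⟧ * ⟦ does ((y ∙ x) ≟F 0F) ⟧) ≡ ⟦ does (π h x ≟F 0F) ⟧ + ⟦ does (π h x ≟F 0F) ⟧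
  normals-annihilate x h = begin
    ∑ (allV d) (λ y → ⟦ IsNormalOf h y ⟧ * D y)
      ≡⟨ ∑-cong (allV d) (λ y → trans (cong (_* D y) (⟦IsNormalOf⟧ h y)) (*-distribʳ-+ (D y) ⟦ does (y ≟V normal h) ⟧ ⟦ does (y ≟V -V normal h) ⟧)) ⟩
    ∑ (allV d) (λ y → ⟦ does (y ≟V normal h) ⟧ * D y + ⟦ does (y ≟V -V normal h) ⟧ * D y)
      ≡⟨ ∑-distrib-+ (allV d) _ _ ⟩
    ∑ (allV d) (λ y → ⟦ does (y ≟V normal h) ⟧ * D y) + ∑ (allV d) (λ y → ⟦ does (y ≟V -V normal h) ⟧ * D y)
      ≡⟨ cong₂ _+_ (EV.∑-δ (normal h) D) (EV.∑-δ (-V normal h) D) ⟩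
    D (normal h) + D (-V normal h)
      ≡⟨ cong₂ _+_ (cong (λ z → ⟦ does (z ≟F 0F) ⟧) (sym (π≡normal∙ h x)))
                   (cong ⟦_⟧ (trans (cong (λ z → does (z ≟F 0F))
                                    (trans (proj₂ (∙-linearˡ x) 2F (normal h)) (cong (2F *₃_) (sym (π≡normal∙ h x)))))
                              (-x≟0 (π h x)))) ⟩
    ⟦ does (π h x ≟F 0F) ⟧ + ⟦ does (π h x ≟F 0F) ⟧ ∎
    where
    open ≡-Reasoning
    D : V d → ℕ
    D y = ⟦ does ((y ∙ x) ≟F 0F) ⟧

  -- y ∙ x = 0 holds for y = 0 and for the two normals ±normal h of each hyperplane containing x.
  annihilator-size : ∀ x → ∑ (allV d) (λ y → ⟦ does ((y ∙ x) ≟F 0F) ⟧) ≡ 1 + 2 * kernels∋ x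
  annihilator-size x = begin
    ∑ (allV d) D
      ≡⟨ ∑-cong (allV d) (λ y → split (does (y ≟V 0V)) (D y)) ⟩
    ∑ (allV d) (λ y → ⟦ does (y ≟V 0V) ⟧ * D y + ⟦ not (does (y ≟V 0V)) ⟧ * D y)
      ≡⟨ ∑-distrib-+ (allV d) _ _ ⟩
    ∑ (allV d) (λ y → ⟦ does (y ≟V 0V) ⟧ * D y) + ∑ (allV d) (λ y → ⟦ not (does (y ≟V 0V)) ⟧ * D y)
      ≡⟨ cong₂ _+_ (trans (EV.∑-δ 0V D) D0≡1) (∑-cong (allV d) (λ y → cong (_* D y) (nonzero-normal-of-one y))) ⟩
    1 + ∑ (allV d) (λ y → ∑ (allFin r) (λ h → ⟦ IsNormalOf h y ⟧) * D y)
      ≡⟨ cong (1 +_) (∑-cong (allV d) (λ y → sym (∑-*ʳ (allFin r) (D y) (λ h → ⟦ IsNormalOf h y ⟧)))) ⟩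
    1 + ∑ (allV d) (λ y → ∑ (allFin r) (λ h → ⟦ IsNormalOf h y ⟧ * D y))
      ≡⟨ cong (1 +_) (∑-comm (allV d) (allFin r) _) ⟩
    1 + ∑ (allFin r) (λ h → ∑ (allV d) (λ y → ⟦ IsNormalOf h y ⟧ * D y))
      ≡⟨ cong (1 +_) (∑-cong (allFin r) (normals-annihilate x)) ⟩
    1 + ∑ (allFin r) (λ h → ⟦ does (π h x ≟F 0F) ⟧ + ⟦ does (π h x ≟F 0F) ⟧)
      ≡⟨ cong (1 +_) (trans (∑-distrib-+ (allFin r) _ _) (cong (kernels∋ x +_) (sym (+-identityʳ (kernels∋ x))))) ⟩
    1 + 2 * kernels∋ x ∎
    where
    open ≡-Reasoning
    D : V d → ℕ
    D y = ⟦ does ((y ∙ x) ≟F 0F) ⟧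
    D0≡1 : D 0V ≡ 1
    D0≡1 = cong ⟦_⟧ (dec-true ((0V ∙ x) ≟F 0F) (0V-∙ x))
    split : ∀ b n → n ≡ ⟦ b ⟧ * n + ⟦ not b ⟧ * n
    split true n = sym (trans (+-identityʳ (n + 0)) (+-identityʳ n))
    split false n = sym (+-identityʳ n)

  agreements : V d → V d → ℕ
  agreements u v = ∑ (allFin r) (λ h → ⟦ does (π h u ≟F π h v) ⟧)

  agreements-count : ∀ u v → u ≢ v → 3 * (1 + 2 * agreements u v) ≡ 3 ^ d
  agreements-count u v u≢v = begin
    3 * (1 + 2 * agreements u v) ≡⟨ cong (λ z → 3 * (1 + 2 * z)) agreements≡kernels∋ ⟩
    3 * (1 + 2 * kernels∋ x)     ≡⟨ cong (3 *_) (sym (annihilator-size x)) ⟩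
    3 * fibre (_∙ x) 0F          ≡⟨ fibre-size (_∙ x) (∙-linearˡ x) (∙-surjectiveˡ x x≢0) 0F ⟩
    3 ^ d                        ∎
    where
    open ≡-Reasoning
    x : V d
    x = u +V (-V v)
    x≢0 : ¬ x ≡ 0V
    x≢0 x≡0 = u≢v (difference≡0⇒≡ u v x≡0)
    agreements≡kernels∋ : agreements u v ≡ kernels∋ x
    agreements≡kernels∋ = ∑-cong (allFin r) λ h → cong ⟦_⟧ (trans (≟-via-difference (π h u) (π h v))
      (cong (λ z → does (z ≟F 0F)) (sym (trans (proj₁ (π-linear h) u _) (cong (π h u +₃_) (proj₂ (π-linear h) 2F v))))))

cyc^ : Fin 3 → Bool → Fin 3 → Fin 3
cyc^ 0F b x = x
cyc^ 1F b x = cyc b x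
cyc^ 2F b x = cyc b (cyc b x)

cyc^-inverseˡ : ∀ b k x → cyc^ k (not b) (cyc^ k b x) ≡ x
cyc^-inverseˡ true = from-yes (all? λ k → all? λ x → cyc^ k false (cyc^ k true x) ≟F x)
cyc^-inverseˡ false = from-yes (all? λ k → all? λ x → cyc^ k true (cyc^ k false x) ≟F x)

cyc^-inverseʳ : ∀ b k x → cyc^ k b (cyc^ k (not b) x) ≡ x
cyc^-inverseʳ true = from-yes (all? λ k → all? λ x → cyc^ k true (cyc^ k false x) ≟F x)
cyc^-inverseʳ false = from-yes (all? λ k → all? λ x → cyc^ k false (cyc^ k true x) ≟F x)

cyc^-injectiveˡ : ∀ b k l x → cyc^ k b x ≡ cyc^ l b x → k ≡ l
cyc^-injectiveˡ true = from-yes (all? λ k → all? λ l → all? λ x → (cyc^ k true x ≟F cyc^ l true x) →-dec (k ≟F l))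
cyc^-injectiveˡ false = from-yes (all? λ k → all? λ l → all? λ x → (cyc^ k false x ≟F cyc^ l false x) →-dec (k ≟F l))

cyc^-reaches : ∀ b s t → ∃[ k ] cyc^ k b s ≡ t
cyc^-reaches true = from-yes (all? λ s → all? λ t → any? λ k → cyc^ k true s ≟F t)
cyc^-reaches false = from-yes (all? λ s → all? λ t → any? λ k → cyc^ k false s ≟F t)

-- For k ≠ l the differences k - l and l - k are the two nonzero elements of ℤ₃, so exactly one
-- of the two equations holds when p ≠ q, and neither when p = q.
cyc^-pair : ∀ b k l p q →
  ⟦ does (cyc^ k b p ≟F cyc^ l b q) ⟧ + ⟦ does (cyc^ l b p ≟F cyc^ k b q) ⟧
    ≡ (if does (k ≟F l) then 2 * ⟦ does (p ≟F q) ⟧ else ⟦ not (does (p ≟F q)) ⟧)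
cyc^-pair true = from-yes (all? λ k → all? λ l → all? λ p → all? λ q →
  ⟦ does (cyc^ k true p ≟F cyc^ l true q) ⟧ + ⟦ does (cyc^ l true p ≟F cyc^ k true q) ⟧
    ≟ℕ (if does (k ≟F l) then 2 * ⟦ does (p ≟F q) ⟧ else ⟦ not (does (p ≟F q)) ⟧))
cyc^-pair false = from-yes (all? λ k → all? λ l → all? λ p → all? λ q →
  ⟦ does (cyc^ k false p ≟F cyc^ l false q) ⟧ + ⟦ does (cyc^ l false p ≟F cyc^ k false q) ⟧
    ≟ℕ (if does (k ≟F l) then 2 * ⟦ does (p ≟F q) ⟧ else ⟦ not (does (p ≟F q)) ⟧))

module _ {X : Set} (els : List X) where

  meet-cong : {C C′ D D′ : X → X → Bool} → (∀ α β → C α β ≡ C′ α β) → (∀ α β → D α β ≡ D′ α β) →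
    ∀ α β → meet els C D α β ≡ meet els C′ D′ α β
  meet-cong C≗C′ D≗D′ α β = count-cong els (λ γ → cong₂ _∧_ (C≗C′ α γ) (D≗D′ γ β))

  IsJordanScheme-cong : {k : ℕ} {C C′ : Fin k → X → X → Bool} → (∀ c α β → C c α β ≡ C′ c α β) →
    IsJordanScheme els C → IsJordanScheme els C′
  IsJordanScheme-cong {C = C} {C′} C≗C′
    ((((nonempty , covers , disjoint) , diagonal-or-off , transposes) , jordan) , (c₀ , c₀-diagonal)) =
    (((nonempty′ , covers′ , disjoint′) , diagonal-or-off′ , transposes′) , jordan′) ,
    (c₀ , λ α β → ⇔-trans (C′⇔C c₀ α β) (c₀-diagonal α β))
    where
    C′⇔C : ∀ c α β → T (C′ c α β) ⇔ T (C c α β)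
    C′⇔C c α β = mk⇔ (subst T (sym (C≗C′ c α β))) (subst T (C≗C′ c α β))
    nonempty′ : ∀ c → ∃[ α ] ∃[ β ] T (C′ c α β)
    nonempty′ c = let (α , β , t) = nonempty c in α , β , Equivalence.from (C′⇔C c α β) t
    covers′ : ∀ α β → ∃[ c ] T (C′ c α β)
    covers′ α β = let (c , t) = covers α β in c , Equivalence.from (C′⇔C c α β) t
    disjoint′ : ∀ α β c c′ → T (C′ c α β) → T (C′ c′ α β) → c ≡ c′
    disjoint′ α β c c′ t t′ = disjoint α β c c′ (Equivalence.to (C′⇔C c α β) t) (Equivalence.to (C′⇔C c′ α β) t′)
    diagonal-or-off′ : ∀ c → (∀ α β → T (C′ c α β) → α ≡ β) ⊎ (∀ α β → T (C′ c α β) → α ≢ β)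
    diagonal-or-off′ c with diagonal-or-off c
    ... | inj₁ diagonal = inj₁ λ α β t → diagonal α β (Equivalence.to (C′⇔C c α β) t)
    ... | inj₂ off = inj₂ λ α β t → off α β (Equivalence.to (C′⇔C c α β) t)
    transposes′ : ∀ c → ∃[ c′ ] (∀ α β → T (C′ c′ α β) ⇔ T (C′ c β α))
    transposes′ c = let (c′ , c′⇔cᵀ) = transposes c in
      c′ , λ α β → ⇔-trans (C′⇔C c′ α β) (⇔-trans (c′⇔cᵀ α β) (⇔-sym (C′⇔C c β α)))
    jordan′ : ∀ c c′ e α β α′ β′ → T (C′ e α β) → T (C′ e α′ β′) →
      meet els (C′ c) (C′ c′) α β + meet els (C′ c′) (C′ c) α β
        ≡ meet els (C′ c) (C′ c′) α′ β′ + meet els (C′ c′) (C′ c) α′ β′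
    jordan′ c c′ e α β α′ β′ t t′ = begin
      meet els (C′ c) (C′ c′) α β + meet els (C′ c′) (C′ c) α β       ≡⟨ cong₂ _+_ (from-C c c′ α β) (from-C c′ c α β) ⟩
      meet els (C c) (C c′) α β + meet els (C c′) (C c) α β           ≡⟨ jordan c c′ e α β α′ β′ (Equivalence.to (C′⇔C e α β) t) (Equivalence.to (C′⇔C e α′ β′) t′) ⟩
      meet els (C c) (C c′) α′ β′ + meet els (C c′) (C c) α′ β′       ≡⟨ sym (cong₂ _+_ (from-C c c′ α′ β′) (from-C c′ c α′ β′)) ⟩
      meet els (C′ c) (C′ c′) α′ β′ + meet els (C′ c′) (C′ c) α′ β′   ∎
      where
      open ≡-Reasoning
      from-C : ∀ a b α β → meet els (C′ a) (C′ b) α β ≡ meet els (C a) (C b) α β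
      from-C a b = meet-cong (λ α β → sym (C≗C′ a α β)) (λ α β → sym (C≗C′ b α β))

module _ {d r : ℕ} where

  meet≡∑-layers : (C D : Ω d r → Ω d r → Bool) (α β : Ω d r) →
    meet (allΩ d r) C D α β ≡ ∑ (allFin (suc r)) (λ m → ∑ (allV d) (λ w → ⟦ C α (w , m) ⟧ * ⟦ D (w , m) β ⟧))
  meet≡∑-layers C D α β = begin
    meet (allΩ d r) C D α β
      ≡⟨ count≡∑ (allΩ d r) (λ γ → C α γ ∧ D γ β) ⟩
    ∑ (allΩ d r) (λ γ → ⟦ C α γ ∧ D γ β ⟧)
      ≡⟨ ∑-cartesianProduct (allV d) (allFin (suc r)) (λ γ → ⟦ C α γ ∧ D γ β ⟧) ⟩
    ∑ (allV d) (λ w → ∑ (allFin (suc r)) (λ m → ⟦ C α (w , m) ∧ D (w , m) β ⟧))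
      ≡⟨ ∑-cong (allV d) (λ w → ∑-cong (allFin (suc r)) (λ m → ⟦∧⟧ (C α (w , m)) (D (w , m) β))) ⟩
    ∑ (allV d) (λ w → ∑ (allFin (suc r)) (λ m → ⟦ C α (w , m) ⟧ * ⟦ D (w , m) β ⟧))
      ≡⟨ ∑-comm (allV d) (allFin (suc r)) (λ w m → ⟦ C α (w , m) ⟧ * ⟦ D (w , m) β ⟧) ⟩
    ∑ (allFin (suc r)) (λ m → ∑ (allV d) (λ w → ⟦ C α (w , m) ⟧ * ⟦ D (w , m) β ⟧)) ∎
    where open ≡-Reasoning

  ⟦∧⟧*-assoc : ∀ a b n → ⟦ a ∧ b ⟧ * n ≡ ⟦ a ⟧ * (⟦ b ⟧ * n)
  ⟦∧⟧*-assoc a b n = trans (cong (_* n) (⟦∧⟧ a b)) (*-assoc ⟦ a ⟧ ⟦ b ⟧ n)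

  *⟦∧⟧-assoc : ∀ a b n → n * ⟦ a ∧ b ⟧ ≡ ⟦ a ⟧ * (n * ⟦ b ⟧)
  *⟦∧⟧-assoc a b n = trans (*-comm n _) (trans (⟦∧⟧*-assoc a b n) (cong (⟦ a ⟧ *_) (*-comm ⟦ b ⟧ n)))

  meet-Oneˡ : (D : Ω d r → Ω d r → Bool) (u : V d) (i : Fin (suc r)) (β : Ω d r) →
    meet (allΩ d r) One D (u , i) β ≡ ⟦ D (u , i) β ⟧
  meet-Oneˡ D u i β = trans (meet≡∑-layers One D (u , i) β)
    (trans (∑-cong (allFin (suc r)) λ m →
              trans (∑-cong (allV d) (λ w → ⟦∧⟧*-assoc (does (i ≟F m)) (does (u ≟V w)) ⟦ D (w , m) β ⟧))
              (trans (∑-*ˡ (allV d) ⟦ does (i ≟F m) ⟧ (λ w → ⟦ does (u ≟V w) ⟧ * ⟦ D (w , m) β ⟧))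
                     (cong (⟦ does (i ≟F m) ⟧ *_) (EV.∑-δ′ u (λ w → ⟦ D (w , m) β ⟧)))))
    (EF.∑-δ′ i (λ m → ⟦ D (u , m) β ⟧)))

  meet-Oneʳ : (D : Ω d r → Ω d r → Bool) (α : Ω d r) (v : V d) (j : Fin (suc r)) →
    meet (allΩ d r) D One α (v , j) ≡ ⟦ D α (v , j) ⟧
  meet-Oneʳ D α v j = trans (meet≡∑-layers D One α (v , j))
    (trans (∑-cong (allFin (suc r)) λ m →
              trans (∑-cong (allV d) (λ w → trans (*⟦∧⟧-assoc (does (m ≟F j)) (does (w ≟V v)) ⟦ D α (w , m) ⟧)
                                                  (cong (⟦ does (m ≟F j) ⟧ *_) (*-comm ⟦ D α (w , m) ⟧ _))))
              (trans (∑-*ˡ (allV d) ⟦ does (m ≟F j) ⟧ (λ w → ⟦ does (w ≟V v) ⟧ * ⟦ D α (w , m) ⟧))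
                     (cong (⟦ does (m ≟F j) ⟧ *_) (EV.∑-δ v (λ w → ⟦ D α (w , m) ⟧)))))
    (EF.∑-δ j (λ m → ⟦ D α (v , m) ⟧)))

  meet-Sˡ : (D : Ω d r → Ω d r → Bool) (u : V d) (i : Fin (suc r)) (β : Ω d r) →
    meet (allΩ d r) S D (u , i) β ≡ ∑ (allV d) (λ w → ⟦ not (does (u ≟V w)) ⟧ * ⟦ D (w , i) β ⟧)
  meet-Sˡ D u i β = trans (meet≡∑-layers S D (u , i) β)
    (trans (∑-cong (allFin (suc r)) λ m →
              trans (∑-cong (allV d) (λ w → ⟦∧⟧*-assoc (does (i ≟F m)) (not (does (u ≟V w))) ⟦ D (w , m) β ⟧))
                    (∑-*ˡ (allV d) ⟦ does (i ≟F m) ⟧ (λ w → ⟦ not (does (u ≟V w)) ⟧ * ⟦ D (w , m) β ⟧)))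
    (EF.∑-δ′ i (λ m → ∑ (allV d) (λ w → ⟦ not (does (u ≟V w)) ⟧ * ⟦ D (w , m) β ⟧))))

  meet-Sʳ : (D : Ω d r → Ω d r → Bool) (α : Ω d r) (v : V d) (j : Fin (suc r)) →
    meet (allΩ d r) D S α (v , j) ≡ ∑ (allV d) (λ w → ⟦ D α (w , j) ⟧ * ⟦ not (does (w ≟V v)) ⟧)
  meet-Sʳ D α v j = trans (meet≡∑-layers D S α (v , j))
    (trans (∑-cong (allFin (suc r)) λ m →
              trans (∑-cong (allV d) (λ w → *⟦∧⟧-assoc (does (m ≟F j)) (not (does (w ≟V v))) ⟦ D α (w , m) ⟧))
                    (∑-*ˡ (allV d) ⟦ does (m ≟F j) ⟧ (λ w → ⟦ D α (w , m) ⟧ * ⟦ not (does (w ≟V v)) ⟧)))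
    (EF.∑-δ j (λ m → ∑ (allV d) (λ w → ⟦ D α (w , m) ⟧ * ⟦ not (does (w ≟V v)) ⟧))))

  meet-S-S : (u : V d) (i : Fin (suc r)) (v : V d) (j : Fin (suc r)) →
    meet (allΩ d r) S S (u , i) (v , j) + 2 * ⟦ does (i ≟F j) ⟧ ≡ ⟦ does (i ≟F j) ⟧ * (3 ^ d + ⟦ does (u ≟V v) ⟧)
  meet-S-S u i v j = begin
    meet (allΩ d r) S S (u , i) (v , j) + 2 * δij
      ≡⟨ cong (_+ 2 * δij) (trans (meet-Sˡ S u i (v , j)) (∑-cong (allV d) λ w →
           *⟦∧⟧-assoc (does (i ≟F j)) (not (does (w ≟V v))) ⟦ not (does (u ≟V w)) ⟧)) ⟩
    ∑ (allV d) (λ w → δij * avoid w) + 2 * δij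
      ≡⟨ cong (_+ 2 * δij) (∑-*ˡ (allV d) δij avoid) ⟩
    δij * ∑ (allV d) avoid + 2 * δij
      ≡⟨ cong (δij * ∑ (allV d) avoid +_) (*-comm 2 δij) ⟩
    δij * ∑ (allV d) avoid + δij * 2
      ≡⟨ sym (*-distribˡ-+ δij _ 2) ⟩
    δij * (∑ (allV d) avoid + 2)
      ≡⟨ cong (δij *_) (trans (EV.∑-except-two u v) (cong (_+ ⟦ does (u ≟V v) ⟧) (∑-allV-1 d))) ⟩
    δij * (3 ^ d + ⟦ does (u ≟V v) ⟧) ∎
    where
    open ≡-Reasoning
    δij : ℕ
    δij = ⟦ does (i ≟F j) ⟧
    avoid : V d → ℕ
    avoid w = ⟦ not (does (u ≟V w)) ⟧ * ⟦ not (does (w ≟V v)) ⟧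

  One⇒≡ : (u : V d) (i : Fin (suc r)) (v : V d) (j : Fin (suc r)) → T (One (u , i) (v , j)) → i ≡ j × u ≡ v
  One⇒≡ u i v j t = let (i≟j , u≟v) = Equivalence.to T-∧ t in T-does (i ≟F j) i≟j , T-does (u ≟V v) u≟v

  S⇒same-layer : (u : V d) (i : Fin (suc r)) (v : V d) (j : Fin (suc r)) → T (S (u , i) (v , j)) → i ≡ j × u ≢ v
  S⇒same-layer u i v j t = let (i≟j , u≢v) = Equivalence.to T-∧ t in
    T-does (i ≟F j) i≟j , λ u≡v → subst (λ b → T (not b)) (dec-true (u ≟V v) u≡v) u≢v

module _ {d r : ℕ} {π : Fin r → V d → Fin 3} {_⋄_ : Fin (suc r) → Fin (suc r) → Fin (suc r)}
         (τ : Fin (suc r) → Fin (suc r) → Fin 3 → Fin 3) where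

  Rel-irreflexive : ∀ u w i → Rel π _⋄_ τ (u , i) (w , i) ≡ false
  Rel-irreflexive u w i with <-cmp i i
  ... | tri< _ i≢i _ = ⊥-elim (i≢i refl)
  ... | tri≈ _ _ _ = refl
  ... | tri> _ i≢i _ = ⊥-elim (i≢i refl)

  Rel⇒layers≢ : ∀ u i v j → T (Rel π _⋄_ τ (u , i) (v , j)) → i ≢ j
  Rel⇒layers≢ u i v .i t refl = subst T (Rel-irreflexive u v i) t

  Rel-sym : ∀ u i v j → Rel π _⋄_ τ (u , i) (v , j) ≡ Rel π _⋄_ τ (v , j) (u , i)
  Rel-sym u i v j with <-cmp i j | <-cmp j i
  ... | tri< _ _ _ | tri> _ _ _ = refl
  ... | tri≈ _ _ _ | tri≈ _ _ _ = refl
  ... | tri> _ _ _ | tri< _ _ _ = refl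
  ... | tri< i<j _ _ | tri< _ _ i>j = ⊥-elim (i>j i<j)
  ... | tri< _ i≢j _ | tri≈ _ j≡i _ = ⊥-elim (i≢j (sym j≡i))
  ... | tri≈ _ i≡j _ | tri< _ j≢i _ = ⊥-elim (j≢i (sym i≡j))
  ... | tri≈ _ i≡j _ | tri> _ j≢i _ = ⊥-elim (j≢i (sym i≡j))
  ... | tri> _ _ i>j | tri> i<j _ _ = ⊥-elim (i<j i>j)
  ... | tri> _ i≢j _ | tri≈ _ j≡i _ = ⊥-elim (i≢j (sym j≡i))

x+n≡m⇒x≡m∸n : ∀ x n m → x + n ≡ m → x ≡ m ∸ n
x+n≡m⇒x≡m∸n x n m x+n≡m = trans (sym (m+n∸n≡m x n)) (cong (_∸ n) x+n≡m)

module _ {d r : ℕ} where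

  meet-S-S-same-layer : (u : V d) (i : Fin (suc r)) (v : V d) →
    meet (allΩ d r) S S (u , i) (v , i) ≡ (3 ^ d + ⟦ does (u ≟V v) ⟧) ∸ 2
  meet-S-S-same-layer u i v = x+n≡m⇒x≡m∸n _ 2 _
    (trans (subst (λ b → meet (allΩ d r) S S (u , i) (v , i) + 2 * ⟦ b ⟧ ≡ ⟦ b ⟧ * (3 ^ d + ⟦ does (u ≟V v) ⟧))
                  (dec-true (i ≟F i) refl) (meet-S-S u i v i))
           (+-identityʳ _))

  meet-S-S-other-layer : (u : V d) (i : Fin (suc r)) (v : V d) (j : Fin (suc r)) → i ≢ j →
    meet (allΩ d r) S S (u , i) (v , j) ≡ 0
  meet-S-S-other-layer u i v j i≢j = trans (sym (+-identityʳ _))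
    (subst (λ b → meet (allΩ d r) S S (u , i) (v , j) + 2 * ⟦ b ⟧ ≡ ⟦ b ⟧ * (3 ^ d + ⟦ does (u ≟V v) ⟧))
           (dec-false (i ≟F j) i≢j) (meet-S-S u i v j))

  jordanSum : (C D : Ω d r → Ω d r → Bool) → Ω d r → Ω d r → ℕ
  jordanSum C D α β = meet (allΩ d r) C D α β + meet (allΩ d r) D C α β

fibre-∩ : {d : ℕ} (f : V d → Fin 3) (a b : Fin 3) →
  ∑ (allV d) (λ w → ⟦ does (f w ≟F a) ⟧ * ⟦ does (f w ≟F b) ⟧) ≡ fibre f a * ⟦ does (a ≟F b) ⟧
fibre-∩ {d} f a b = trans (∑-cong (allV d) pointwise) (∑-*ʳ (allV d) ⟦ does (a ≟F b) ⟧ (λ w → ⟦ does (f w ≟F a) ⟧))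
  where
  pointwise : ∀ w → ⟦ does (f w ≟F a) ⟧ * ⟦ does (f w ≟F b) ⟧ ≡ ⟦ does (f w ≟F a) ⟧ * ⟦ does (a ≟F b) ⟧
  pointwise w with f w ≟F a
  ... | yes fw≡a = cong (λ z → 1 * ⟦ does (z ≟F b) ⟧) fw≡a
  ... | no _ = refl

q*x≡n⇒x≡n/q : ∀ q x n .{{_ : NonZero q}} → q * x ≡ n → x ≡ n / q
q*x≡n⇒x≡n/q q x n q*x≡n = trans (sym (m*n/n≡m x q)) (cong (_/ q) (trans (*-comm x q) q*x≡n))

module Construction {d r : ℕ} (π : Fin r → V d → Fin 3)
  (π-linear : ∀ h → IsLinear (π h)) (π-onto : ∀ h → IsSurjective (π h))
  (π-distinct : ∀ h h′ → h ≢ h′ → ¬ SameKernel (π h) (π h′))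
  (π-complete : ∀ (f : V d → Fin 3) → IsLinear f → IsSurjective f → ∃[ h ] SameKernel f (π h))
  (_⋄_ : Fin (suc r) → Fin (suc r) → Fin (suc r)) (⋄-diagonal : ∀ a → a ⋄ a ≡ fzero)
  (⋄-bijective : ∀ a → Bijective _≡_ _≡_ (a ⋄_))
  (σ : Fin (suc r) → Fin (suc r) → Permutation′ 3) (θ : Fin (suc r) → Fin (suc r) → Bool) where

  open Hyperplanes π π-linear π-onto π-distinct π-complete

  τ : Fin 3 → Fin (suc r) → Fin (suc r) → Fin 3 → Fin 3
  τ k i j x = cyc^ k (θ i j) (σ i j ⟨$⟩ʳ x)

  R : Fin 3 → Ω d r → Ω d r → Bool
  R k = Rel π _⋄_ (τ k)

  𝒞 : Fin 5 → Ω d r → Ω d r → Bool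
  𝒞 0F = One
  𝒞 1F = S
  𝒞 (fsuc (fsuc k)) = R k

  classes≗𝒞 : ∀ c α β → classes π _⋄_ σ θ c α β ≡ 𝒞 c α β
  classes≗𝒞 0F α β = refl
  classes≗𝒞 1F α β = refl
  classes≗𝒞 (fsuc (fsuc 0F)) α β = refl
  classes≗𝒞 (fsuc (fsuc 1F)) α β = refl
  classes≗𝒞 (fsuc (fsuc 2F)) α β = refl

  ⋄-injective : ∀ a {x y} → a ⋄ x ≡ a ⋄ y → x ≡ y
  ⋄-injective a = proj₁ (⋄-bijective a)

  ⋄≢0 : ∀ m i → m ≢ i → m ⋄ i ≢ fzero
  ⋄≢0 m i m≢i m⋄i≡0 = m≢i (sym (⋄-injective m (trans m⋄i≡0 (sym (⋄-diagonal m)))))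

  -- 3^(d-1) and, when d ≥ 2, 3^(d-2); the truncated divisions are justified by πx-fibre and πx-jointFibre.
  fibreSize : ℕ
  fibreSize = 3 ^ d / 3

  jointFibreSize : ℕ
  jointFibreSize = 3 ^ d / 9

  πx-fibre : ∀ n c → n ≢ fzero → fibre (πx π n) c ≡ fibreSize
  πx-fibre fzero c n≢0 = ⊥-elim (n≢0 refl)
  πx-fibre (fsuc h) c _ = q*x≡n⇒x≡n/q 3 _ _ (fibre-size (π h) (π-linear h) (π-onto h) c)

  πx-jointFibre : ∀ n n′ c c′ → n ≢ fzero → n′ ≢ fzero → n ≢ n′ → jointFibre (πx π n) (πx π n′) c c′ ≡ jointFibreSize
  πx-jointFibre fzero n′ c c′ n≢0 _ _ = ⊥-elim (n≢0 refl)
  πx-jointFibre (fsuc h) fzero c c′ _ n′≢0 _ = ⊥-elim (n′≢0 refl)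
  πx-jointFibre (fsuc h) (fsuc h′) c c′ _ _ n≢n′
    with separating-vectors (π h) (π h′) (π-linear h) (π-linear h′) (π-onto h) (π-onto h′)
                            (π-distinct h h′ (λ h≡h′ → n≢n′ (cong fsuc h≡h′)))
  ... | a , b , fa , ga , fb , gb =
    q*x≡n⇒x≡n/q 9 _ _ (joint-fibre-size (π h) (π h′) (π-linear h) (π-linear h′) a b fa ga fb gb c c′)

  -- For m ≠ i, (u , i) R k (w , m) iff π_{m⋄i}(w) is this value; at m = i it is junk.
  target : Fin 3 → V d → Fin (suc r) → Fin (suc r) → Fin 3
  target k u i m with <-cmp i m
  ... | tri< _ _ _ = τ k i m (πx π (i ⋄ m) u)
  ... | tri≈ _ _ _ = 0F
  ... | tri> _ _ _ = σ m i ⟨$⟩ˡ cyc^ k (not (θ m i)) (πx π (i ⋄ m) u)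

  R≡target : ∀ k u w i m → i ≢ m → R k (u , i) (w , m) ≡ does (πx π (m ⋄ i) w ≟F target k u i m)
  R≡target k u w i m i≢m with <-cmp i m
  ... | tri≈ _ i≡m _ = ⊥-elim (i≢m i≡m)
  ... | tri< _ _ _ = does-sym _≟F_ (τ k i m (πx π (i ⋄ m) u)) (πx π (m ⋄ i) w)
  ... | tri> _ _ _ = does-cong solve unsolve (cyc^ k (θ m i) (s ⟨$⟩ʳ p) ≟F q) (p ≟F (s ⟨$⟩ˡ cyc^ k (not (θ m i)) q))
    where
    p : Fin 3
    p = πx π (m ⋄ i) w
    q : Fin 3
    q = πx π (i ⋄ m) u
    s : Permutation′ 3
    s = σ m i
    solve : cyc^ k (θ m i) (s ⟨$⟩ʳ p) ≡ q → p ≡ s ⟨$⟩ˡ cyc^ k (not (θ m i)) q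
    solve e = trans (sym (inverseˡ s)) (cong (s ⟨$⟩ˡ_) (trans (sym (cyc^-inverseˡ (θ m i) k _)) (cong (cyc^ k (not (θ m i))) e)))
    unsolve : p ≡ s ⟨$⟩ˡ cyc^ k (not (θ m i)) q → cyc^ k (θ m i) (s ⟨$⟩ʳ p) ≡ q
    unsolve e = trans (cong (λ z → cyc^ k (θ m i) (s ⟨$⟩ʳ z)) e) (trans (cong (cyc^ k (θ m i)) (inverseʳ s)) (cyc^-inverseʳ (θ m i) k q))

  Agreement : Fin 3 → Fin 3 → Fin 3 → Fin 3 → ℕ
  Agreement k l p q = if does (k ≟F l) then 2 * ⟦ does (p ≟F q) ⟧ else ⟦ not (does (p ≟F q)) ⟧

  targets-pair : ∀ k l u v i m → i ≢ m →
    ⟦ does (target k u i m ≟F target l v i m) ⟧ + ⟦ does (target l u i m ≟F target k v i m) ⟧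
      ≡ Agreement k l (πx π (i ⋄ m) u) (πx π (i ⋄ m) v)
  targets-pair k l u v i m i≢m with <-cmp i m
  ... | tri≈ _ i≡m _ = ⊥-elim (i≢m i≡m)
  ... | tri< _ _ _ = trans (cyc^-pair (θ i m) k l (s ⟨$⟩ʳ a) (s ⟨$⟩ʳ b))
      (cong (λ z → if does (k ≟F l) then 2 * ⟦ z ⟧ else ⟦ not z ⟧)
            (does-cong (λ e → trans (sym (inverseˡ s)) (trans (cong (s ⟨$⟩ˡ_) e) (inverseˡ s))) (cong (s ⟨$⟩ʳ_))
                       (s ⟨$⟩ʳ a ≟F s ⟨$⟩ʳ b) (a ≟F b)))
    where
    s : Permutation′ 3
    s = σ i m
    a b : Fin 3
    a = πx π (i ⋄ m) u
    b = πx π (i ⋄ m) v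
  ... | tri> _ _ _ = trans (cong₂ _+_ (cong ⟦_⟧ (s⁻¹-≟ (cyc^ k θ′ a) (cyc^ l θ′ b))) (cong ⟦_⟧ (s⁻¹-≟ (cyc^ l θ′ a) (cyc^ k θ′ b))))
                           (cyc^-pair θ′ k l a b)
    where
    s : Permutation′ 3
    s = σ m i
    θ′ : Bool
    θ′ = not (θ m i)
    a b : Fin 3
    a = πx π (i ⋄ m) u
    b = πx π (i ⋄ m) v
    s⁻¹-≟ : ∀ x y → does ((s ⟨$⟩ˡ x) ≟F (s ⟨$⟩ˡ y)) ≡ does (x ≟F y)
    s⁻¹-≟ x y = does-cong (λ e → trans (sym (inverseʳ s)) (trans (cong (s ⟨$⟩ʳ_) e) (inverseʳ s))) (cong (s ⟨$⟩ˡ_))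
                          (s ⟨$⟩ˡ x ≟F s ⟨$⟩ˡ y) (x ≟F y)

  R-functional : ∀ k l u i v j → T (R k (u , i) (v , j)) → T (R l (u , i) (v , j)) → k ≡ l
  R-functional k l u i v j Rk Rl with <-cmp i j
  ... | tri< _ _ _ = cyc^-injectiveˡ (θ i j) k l s (trans (T-does (cyc^ k (θ i j) s ≟F t) Rk) (sym (T-does (cyc^ l (θ i j) s ≟F t) Rl)))
    where
    s t : Fin 3
    s = σ i j ⟨$⟩ʳ πx π (i ⋄ j) u
    t = πx π (j ⋄ i) v
  ... | tri> _ _ _ = cyc^-injectiveˡ (θ j i) k l s (trans (T-does (cyc^ k (θ j i) s ≟F t) Rk) (sym (T-does (cyc^ l (θ j i) s ≟F t) Rl)))
    where
    s t : Fin 3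
    s = σ j i ⟨$⟩ʳ πx π (j ⋄ i) v
    t = πx π (i ⋄ j) u

  𝒞-disjoint : ∀ c c′ u i v j → T (𝒞 c (u , i) (v , j)) → T (𝒞 c′ (u , i) (v , j)) → c ≡ c′
  𝒞-disjoint 0F 0F u i v j _ _ = refl
  𝒞-disjoint 0F 1F u i v j t t′ = ⊥-elim (proj₂ (S⇒same-layer u i v j t′) (proj₂ (One⇒≡ u i v j t)))
  𝒞-disjoint 0F (fsuc (fsuc l)) u i v j t t′ = ⊥-elim (Rel⇒layers≢ (τ l) u i v j t′ (proj₁ (One⇒≡ u i v j t)))
  𝒞-disjoint 1F 0F u i v j t t′ = ⊥-elim (proj₂ (S⇒same-layer u i v j t) (proj₂ (One⇒≡ u i v j t′)))
  𝒞-disjoint 1F 1F u i v j _ _ = refl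
  𝒞-disjoint 1F (fsuc (fsuc l)) u i v j t t′ = ⊥-elim (Rel⇒layers≢ (τ l) u i v j t′ (proj₁ (S⇒same-layer u i v j t)))
  𝒞-disjoint (fsuc (fsuc k)) 0F u i v j t t′ = ⊥-elim (Rel⇒layers≢ (τ k) u i v j t (proj₁ (One⇒≡ u i v j t′)))
  𝒞-disjoint (fsuc (fsuc k)) 1F u i v j t t′ = ⊥-elim (Rel⇒layers≢ (τ k) u i v j t (proj₁ (S⇒same-layer u i v j t′)))
  𝒞-disjoint (fsuc (fsuc k)) (fsuc (fsuc l)) u i v j t t′ = cong (λ z → fsuc (fsuc z)) (R-functional k l u i v j t t′)

  ⟦𝒞⟧-on-class : ∀ c e u i v j → T (𝒞 e (u , i) (v , j)) → ⟦ 𝒞 c (u , i) (v , j) ⟧ ≡ ⟦ does (c ≟F e) ⟧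
  ⟦𝒞⟧-on-class c e u i v j t with c ≟F e
  ... | yes refl = cong ⟦_⟧ (Equivalence.to T-≡ t)
  ... | no c≢e with 𝒞 c (u , i) (v , j) in 𝒞c
  ...   | true = ⊥-elim (c≢e (𝒞-disjoint c e u i v j (Equivalence.from T-≡ 𝒞c) t))
  ...   | false = refl

  meet-S-R : ∀ l u i v j → i ≢ j → meet (allΩ d r) S (R l) (u , i) (v , j) + ⟦ R l (u , i) (v , j) ⟧ ≡ fibreSize
  meet-S-R l u i v j i≢j = begin
    meet (allΩ d r) S (R l) (u , i) (v , j) + ⟦ R l (u , i) (v , j) ⟧
      ≡⟨ cong (_+ ⟦ R l (u , i) (v , j) ⟧) (meet-Sˡ (R l) u i (v , j)) ⟩
    ∑ (allV d) (λ w → ⟦ not (does (u ≟V w)) ⟧ * ⟦ R l (w , i) (v , j) ⟧) + ⟦ R l (u , i) (v , j) ⟧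
      ≡⟨ EV.∑-except u (λ w → ⟦ R l (w , i) (v , j) ⟧) ⟩
    ∑ (allV d) (λ w → ⟦ R l (w , i) (v , j) ⟧)
      ≡⟨ ∑-cong (allV d) (λ w → cong ⟦_⟧ (trans (Rel-sym (τ l) w i v j) (R≡target l v w j i (i≢j ∘′ sym)))) ⟩
    fibre (πx π (i ⋄ j)) (target l v j i)
      ≡⟨ πx-fibre (i ⋄ j) (target l v j i) (⋄≢0 i j i≢j) ⟩
    fibreSize ∎
    where open ≡-Reasoning

  meet-R-S : ∀ l u i v j → i ≢ j → meet (allΩ d r) (R l) S (u , i) (v , j) + ⟦ R l (u , i) (v , j) ⟧ ≡ fibreSize
  meet-R-S l u i v j i≢j = begin
    meet (allΩ d r) (R l) S (u , i) (v , j) + ⟦ R l (u , i) (v , j) ⟧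
      ≡⟨ cong (_+ ⟦ R l (u , i) (v , j) ⟧) (trans (meet-Sʳ (R l) (u , i) v j)
           (∑-cong (allV d) (λ w → *-comm ⟦ R l (u , i) (w , j) ⟧ _))) ⟩
    ∑ (allV d) (λ w → ⟦ not (does (w ≟V v)) ⟧ * ⟦ R l (u , i) (w , j) ⟧) + ⟦ R l (u , i) (v , j) ⟧
      ≡⟨ cong (_+ ⟦ R l (u , i) (v , j) ⟧) (∑-cong (allV d) (λ w →
           cong (λ b → ⟦ not b ⟧ * ⟦ R l (u , i) (w , j) ⟧) (does-sym _≟V_ w v))) ⟩
    ∑ (allV d) (λ w → ⟦ not (does (v ≟V w)) ⟧ * ⟦ R l (u , i) (w , j) ⟧) + ⟦ R l (u , i) (v , j) ⟧
      ≡⟨ EV.∑-except v (λ w → ⟦ R l (u , i) (w , j) ⟧) ⟩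
    ∑ (allV d) (λ w → ⟦ R l (u , i) (w , j) ⟧)
      ≡⟨ ∑-cong (allV d) (λ w → cong ⟦_⟧ (R≡target l u w i j i≢j)) ⟩
    fibre (πx π (j ⋄ i)) (target l u i j)
      ≡⟨ πx-fibre (j ⋄ i) (target l u i j) (⋄≢0 j i (i≢j ∘′ sym)) ⟩
    fibreSize ∎
    where open ≡-Reasoning

  meet-S-R-same-layer : ∀ l u i v → meet (allΩ d r) S (R l) (u , i) (v , i) ≡ 0
  meet-S-R-same-layer l u i v = trans (meet-Sˡ (R l) u i (v , i)) (trans (∑-cong (allV d) (λ w →
      trans (cong (λ b → ⟦ not (does (u ≟V w)) ⟧ * ⟦ b ⟧) (Rel-irreflexive (τ l) w v i)) (*-zeroʳ ⟦ not (does (u ≟V w)) ⟧)))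
    (∑-zero (allV d)))

  meet-R-S-same-layer : ∀ l u i v → meet (allΩ d r) (R l) S (u , i) (v , i) ≡ 0
  meet-R-S-same-layer l u i v = trans (meet-Sʳ (R l) (u , i) v i) (trans (∑-cong (allV d) (λ w →
      cong (λ b → ⟦ b ⟧ * ⟦ not (does (w ≟V v)) ⟧) (Rel-irreflexive (τ l) u w i)))
    (∑-zero (allV d)))

  through : Fin 3 → Fin 3 → V d → Fin (suc r) → V d → Fin (suc r) → Fin (suc r) → ℕ
  through k l u i v j m = ∑ (allV d) (λ w → ⟦ R k (u , i) (w , m) ⟧ * ⟦ R l (w , m) (v , j) ⟧)

  through-other-layers : ∀ k l u i v j → i ≢ j → ∀ m →
    through k l u i v j m ≡ ⟦ not (does (i ≟F m)) ⟧ * ⟦ not (does (m ≟F j)) ⟧ * jointFibreSize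
  through-other-layers k l u i v j i≢j m with i ≟F m
  ... | yes refl = trans (∑-cong (allV d) (λ w → cong (λ b → ⟦ b ⟧ * ⟦ R l (w , i) (v , j) ⟧) (Rel-irreflexive (τ k) u w i)))
                         (∑-zero (allV d))
  ... | no i≢m with m ≟F j
  ...   | yes refl = trans (∑-cong (allV d) (λ w → trans (cong (λ b → ⟦ R k (u , i) (w , m) ⟧ * ⟦ b ⟧) (Rel-irreflexive (τ l) w v m))
                                                         (*-zeroʳ ⟦ R k (u , i) (w , m) ⟧)))
                           (∑-zero (allV d))
  ...   | no m≢j = begin
    through k l u i v j m
      ≡⟨ ∑-cong (allV d) (λ w → cong₂ (λ b b′ → ⟦ b ⟧ * ⟦ b′ ⟧) (R≡target k u w i m i≢m)
                                   (trans (Rel-sym (τ l) w m v j) (R≡target l v w j m (m≢j ∘′ sym)))) ⟩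
    jointFibre (πx π (m ⋄ i)) (πx π (m ⋄ j)) (target k u i m) (target l v j m)
      ≡⟨ πx-jointFibre (m ⋄ i) (m ⋄ j) _ _ (⋄≢0 m i (i≢m ∘′ sym)) (⋄≢0 m j m≢j) (i≢j ∘′ ⋄-injective m) ⟩
    jointFibreSize
      ≡⟨ sym (+-identityʳ jointFibreSize) ⟩
    1 * jointFibreSize ∎
    where open ≡-Reasoning

  layers-avoiding : ∀ i j → i ≢ j →
    ∑ (allFin (suc r)) (λ m → ⟦ not (does (i ≟F m)) ⟧ * ⟦ not (does (m ≟F j)) ⟧) ≡ r ∸ 1
  layers-avoiding i j i≢j = trans (x+n≡m⇒x≡m∸n _ 2 _ (trans (EF.∑-except-two i j)
      (cong₂ _+_ (∑-allFin-1 (suc r)) (cong ⟦_⟧ (dec-false (i ≟F j) i≢j)))))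
    (cong (_∸ 2) (+-identityʳ (suc r)))

  meet-R-R-other-layer : ∀ k l u i v j → i ≢ j → meet (allΩ d r) (R k) (R l) (u , i) (v , j) ≡ (r ∸ 1) * jointFibreSize
  meet-R-R-other-layer k l u i v j i≢j = begin
    meet (allΩ d r) (R k) (R l) (u , i) (v , j)
      ≡⟨ meet≡∑-layers (R k) (R l) (u , i) (v , j) ⟩
    ∑ (allFin (suc r)) (through k l u i v j)
      ≡⟨ ∑-cong (allFin (suc r)) (through-other-layers k l u i v j i≢j) ⟩
    ∑ (allFin (suc r)) (λ m → ⟦ not (does (i ≟F m)) ⟧ * ⟦ not (does (m ≟F j)) ⟧ * jointFibreSize)
      ≡⟨ ∑-*ʳ (allFin (suc r)) jointFibreSize (λ m → ⟦ not (does (i ≟F m)) ⟧ * ⟦ not (does (m ≟F j)) ⟧) ⟩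
    ∑ (allFin (suc r)) (λ m → ⟦ not (does (i ≟F m)) ⟧ * ⟦ not (does (m ≟F j)) ⟧) * jointFibreSize
      ≡⟨ cong (_* jointFibreSize) (layers-avoiding i j i≢j) ⟩
    (r ∸ 1) * jointFibreSize ∎
    where open ≡-Reasoning

  disagreements : V d → V d → ℕ
  disagreements u v = ∑ (allFin r) (λ h → ⟦ not (does (π h u ≟F π h v)) ⟧)

  agreementProfile : Fin 3 → Fin 3 → V d → V d → ℕ
  agreementProfile k l u v = if does (k ≟F l) then 2 * agreements u v else disagreements u v

  layerAgreement : Fin 3 → Fin 3 → V d → V d → Fin (suc r) → ℕ
  layerAgreement k l u v n = ⟦ not (does (n ≟F fzero)) ⟧ * Agreement k l (πx π n u) (πx π n v)

  through-same-layer : ∀ k l u i v m →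
    through k l u i v i m + through l k u i v i m ≡ fibreSize * layerAgreement k l u v (i ⋄ m)
  through-same-layer k l u i v m with i ≟F m
  ... | yes refl = begin
    through k l u i v i i + through l k u i v i i ≡⟨ cong₂ _+_ (none k l) (none l k) ⟩
    0                                             ≡⟨ sym (*-zeroʳ fibreSize) ⟩
    fibreSize * layerAgreement k l u v fzero      ≡⟨ cong (λ n → fibreSize * layerAgreement k l u v n) (sym (⋄-diagonal i)) ⟩
    fibreSize * layerAgreement k l u v (i ⋄ i)    ∎
    where
    open ≡-Reasoning
    none : ∀ k l → through k l u i v i i ≡ 0
    none k l = trans (∑-cong (allV d) (λ w → cong (λ b → ⟦ b ⟧ * ⟦ R l (w , i) (v , i) ⟧) (Rel-irreflexive (τ k) u w i)))
                     (∑-zero (allV d))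
  ... | no i≢m = begin
    through k l u i v i m + through l k u i v i m
      ≡⟨ cong₂ _+_ (via-layer k l) (via-layer l k) ⟩
    fibreSize * ⟦ does (target k u i m ≟F target l v i m) ⟧ + fibreSize * ⟦ does (target l u i m ≟F target k v i m) ⟧
      ≡⟨ sym (*-distribˡ-+ fibreSize _ _) ⟩
    fibreSize * (⟦ does (target k u i m ≟F target l v i m) ⟧ + ⟦ does (target l u i m ≟F target k v i m) ⟧)
      ≡⟨ cong (fibreSize *_) (targets-pair k l u v i m i≢m) ⟩
    fibreSize * Agreement k l (πx π (i ⋄ m) u) (πx π (i ⋄ m) v)
      ≡⟨ cong (fibreSize *_) (sym (+-identityʳ _)) ⟩
    fibreSize * (1 * Agreement k l (πx π (i ⋄ m) u) (πx π (i ⋄ m) v))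
      ≡⟨ cong (λ b → fibreSize * (⟦ not b ⟧ * Agreement k l (πx π (i ⋄ m) u) (πx π (i ⋄ m) v)))
              (sym (dec-false (i ⋄ m ≟F fzero) (⋄≢0 i m i≢m))) ⟩
    fibreSize * layerAgreement k l u v (i ⋄ m) ∎
    where
    open ≡-Reasoning
    via-layer : ∀ k l → through k l u i v i m ≡ fibreSize * ⟦ does (target k u i m ≟F target l v i m) ⟧
    via-layer k l = begin
      through k l u i v i m
        ≡⟨ ∑-cong (allV d) (λ w → cong₂ (λ b b′ → ⟦ b ⟧ * ⟦ b′ ⟧) (R≡target k u w i m i≢m)
                                     (trans (Rel-sym (τ l) w m v i) (R≡target l v w i m i≢m))) ⟩
      ∑ (allV d) (λ w → ⟦ does (πx π (m ⋄ i) w ≟F target k u i m) ⟧ * ⟦ does (πx π (m ⋄ i) w ≟F target l v i m) ⟧)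
        ≡⟨ fibre-∩ (πx π (m ⋄ i)) (target k u i m) (target l v i m) ⟩
      fibre (πx π (m ⋄ i)) (target k u i m) * ⟦ does (target k u i m ≟F target l v i m) ⟧
        ≡⟨ cong (_* ⟦ does (target k u i m ≟F target l v i m) ⟧) (πx-fibre (m ⋄ i) (target k u i m) (⋄≢0 m i (i≢m ∘′ sym))) ⟩
      fibreSize * ⟦ does (target k u i m ≟F target l v i m) ⟧ ∎

  ∑-layerAgreement : ∀ k l u v → ∑ (allFin (suc r)) (layerAgreement k l u v) ≡ agreementProfile k l u v
  ∑-layerAgreement k l u v = trans (∑-allFin-suc r (layerAgreement k l u v))
    (trans (∑-cong (allFin r) (λ h → +-identityʳ (Agreement k l (π h u) (π h v)))) by-cases)
    where
    by-cases : ∑ (allFin r) (λ h → Agreement k l (π h u) (π h v)) ≡ agreementProfile k l u v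
    by-cases with does (k ≟F l)
    ... | true = ∑-*ˡ (allFin r) 2 (λ h → ⟦ does (π h u ≟F π h v) ⟧)
    ... | false = refl

  jordanSum-R-R-same-layer : ∀ k l u i v → jordanSum (R k) (R l) (u , i) (v , i) ≡ fibreSize * agreementProfile k l u v
  jordanSum-R-R-same-layer k l u i v = begin
    jordanSum (R k) (R l) (u , i) (v , i)
      ≡⟨ cong₂ _+_ (meet≡∑-layers (R k) (R l) (u , i) (v , i)) (meet≡∑-layers (R l) (R k) (u , i) (v , i)) ⟩
    ∑ (allFin (suc r)) (through k l u i v i) + ∑ (allFin (suc r)) (through l k u i v i)
      ≡⟨ sym (∑-distrib-+ (allFin (suc r)) (through k l u i v i) (through l k u i v i)) ⟩
    ∑ (allFin (suc r)) (λ m → through k l u i v i m + through l k u i v i m)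
      ≡⟨ ∑-cong (allFin (suc r)) (through-same-layer k l u i v) ⟩
    ∑ (allFin (suc r)) (λ m → fibreSize * layerAgreement k l u v (i ⋄ m))
      ≡⟨ ∑-*ˡ (allFin (suc r)) fibreSize (λ m → layerAgreement k l u v (i ⋄ m)) ⟩
    fibreSize * ∑ (allFin (suc r)) (λ m → layerAgreement k l u v (i ⋄ m))
      ≡⟨ cong (fibreSize *_) (EF.∑-reindex (i ⋄_) ⋄⁻¹ ⋄-⋄⁻¹ (λ x → ⋄-injective i (⋄-⋄⁻¹ (i ⋄ x))) (layerAgreement k l u v)) ⟩
    fibreSize * ∑ (allFin (suc r)) (layerAgreement k l u v)
      ≡⟨ cong (fibreSize *_) (∑-layerAgreement k l u v) ⟩
    fibreSize * agreementProfile k l u v ∎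
    where
    open ≡-Reasoning
    ⋄⁻¹ : Fin (suc r) → Fin (suc r)
    ⋄⁻¹ y = proj₁ (proj₂ (⋄-bijective i) y)
    ⋄-⋄⁻¹ : ∀ y → i ⋄ ⋄⁻¹ y ≡ y
    ⋄-⋄⁻¹ y = proj₂ (proj₂ (⋄-bijective i) y) refl

  commonAgreements : ℕ
  commonAgreements = (fibreSize ∸ 1) / 2

  agreements-distinct : ∀ u v → u ≢ v → agreements u v ≡ commonAgreements
  agreements-distinct u v u≢v = trans (sym (m*n/n≡m (agreements u v) 2))
    (cong (_/ 2) (trans (*-comm (agreements u v) 2)
      (cong (_∸ 1) (q*x≡n⇒x≡n/q 3 (1 + 2 * agreements u v) (3 ^ d) (agreements-count u v u≢v)))))

  disagreements+agreements : ∀ u v → disagreements u v + agreements u v ≡ r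
  disagreements+agreements u v = trans (sym (∑-distrib-+ (allFin r) _ _))
    (trans (∑-cong (allFin r) (λ h → ⟦not-b⟧+⟦b⟧≡1 (does (π h u ≟F π h v)))) (∑-allFin-1 r))

  agreements-refl : ∀ u → agreements u u ≡ r
  agreements-refl u = trans (∑-cong (allFin r) (λ h → cong ⟦_⟧ (dec-true (π h u ≟F π h u) refl))) (∑-allFin-1 r)

  disagreements-refl : ∀ u → disagreements u u ≡ 0
  disagreements-refl u = trans (∑-cong (allFin r) (λ h → cong (λ b → ⟦ not b ⟧) (dec-true (π h u ≟F π h u) refl)))
                               (∑-zero (allFin r))

  S-S-number : Fin 5 → ℕ
  S-S-number 0F = (3 ^ d + 1) ∸ 2 + ((3 ^ d + 1) ∸ 2)
  S-S-number 1F = 3 ^ d ∸ 2 + (3 ^ d ∸ 2)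
  S-S-number (fsuc (fsuc _)) = 0

  S-R-number : Fin 3 → Fin 5 → ℕ
  S-R-number l 0F = 0
  S-R-number l 1F = 0
  S-R-number l (fsuc (fsuc k)) = fibreSize ∸ ⟦ does (l ≟F k) ⟧ + (fibreSize ∸ ⟦ does (l ≟F k) ⟧)

  R-R-number : Fin 3 → Fin 3 → Fin 5 → ℕ
  R-R-number k l 0F = fibreSize * (if does (k ≟F l) then 2 * r else 0)
  R-R-number k l 1F = fibreSize * (if does (k ≟F l) then 2 * commonAgreements else r ∸ commonAgreements)
  R-R-number k l (fsuc (fsuc _)) = (r ∸ 1) * jointFibreSize + (r ∸ 1) * jointFibreSize

  jordanNumber : Fin 5 → Fin 5 → Fin 5 → ℕ
  jordanNumber 0F c′ e = ⟦ does (c′ ≟F e) ⟧ + ⟦ does (c′ ≟F e) ⟧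
  jordanNumber (fsuc c) 0F e = ⟦ does (fsuc c ≟F e) ⟧ + ⟦ does (fsuc c ≟F e) ⟧
  jordanNumber 1F 1F e = S-S-number e
  jordanNumber 1F (fsuc (fsuc l)) e = S-R-number l e
  jordanNumber (fsuc (fsuc k)) 1F e = S-R-number k e
  jordanNumber (fsuc (fsuc k)) (fsuc (fsuc l)) e = R-R-number k l e

  jordanSum-S-S : ∀ e u i v j → T (𝒞 e (u , i) (v , j)) → jordanSum S S (u , i) (v , j) ≡ S-S-number e
  jordanSum-S-S 0F u i v j t with One⇒≡ u i v j t
  ... | refl , refl = cong₂ _+_ diagonal diagonal
    where
    diagonal : meet (allΩ d r) S S (u , i) (u , i) ≡ (3 ^ d + 1) ∸ 2
    diagonal = trans (meet-S-S-same-layer u i u) (cong (λ b → (3 ^ d + ⟦ b ⟧) ∸ 2) (dec-true (u ≟V u) refl))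
  jordanSum-S-S 1F u i v j t with S⇒same-layer u i v j t
  ... | refl , u≢v = cong₂ _+_ off-diagonal off-diagonal
    where
    off-diagonal : meet (allΩ d r) S S (u , i) (v , i) ≡ 3 ^ d ∸ 2
    off-diagonal = trans (meet-S-S-same-layer u i v)
      (cong (_∸ 2) (trans (cong (λ b → 3 ^ d + ⟦ b ⟧) (dec-false (u ≟V v) u≢v)) (+-identityʳ (3 ^ d))))
  jordanSum-S-S (fsuc (fsuc k)) u i v j t =
    cong₂ _+_ (meet-S-S-other-layer u i v j i≢j) (meet-S-S-other-layer u i v j i≢j)
    where
    i≢j : i ≢ j
    i≢j = Rel⇒layers≢ (τ k) u i v j t

  jordanSum-S-R : ∀ l e u i v j → T (𝒞 e (u , i) (v , j)) → jordanSum S (R l) (u , i) (v , j) ≡ S-R-number l e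
  jordanSum-S-R l 0F u i v j t with One⇒≡ u i v j t
  ... | refl , _ = cong₂ _+_ (meet-S-R-same-layer l u i v) (meet-R-S-same-layer l u i v)
  jordanSum-S-R l 1F u i v j t with S⇒same-layer u i v j t
  ... | refl , _ = cong₂ _+_ (meet-S-R-same-layer l u i v) (meet-R-S-same-layer l u i v)
  jordanSum-S-R l (fsuc (fsuc k)) u i v j t = cong₂ _+_
    (x+n≡m⇒x≡m∸n (meet (allΩ d r) S (R l) (u , i) (v , j)) δlk fibreSize
      (trans (cong (meet (allΩ d r) S (R l) (u , i) (v , j) +_) (sym R-value)) (meet-S-R l u i v j i≢j)))
    (x+n≡m⇒x≡m∸n (meet (allΩ d r) (R l) S (u , i) (v , j)) δlk fibreSize
      (trans (cong (meet (allΩ d r) (R l) S (u , i) (v , j) +_) (sym R-value)) (meet-R-S l u i v j i≢j)))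
    where
    i≢j : i ≢ j
    i≢j = Rel⇒layers≢ (τ k) u i v j t
    δlk : ℕ
    δlk = ⟦ does (l ≟F k) ⟧
    R-value : ⟦ R l (u , i) (v , j) ⟧ ≡ δlk
    R-value = ⟦𝒞⟧-on-class (fsuc (fsuc l)) (fsuc (fsuc k)) u i v j t

  jordanSum-R-R : ∀ k l e u i v j → T (𝒞 e (u , i) (v , j)) → jordanSum (R k) (R l) (u , i) (v , j) ≡ R-R-number k l e
  jordanSum-R-R k l 0F u i v j t with One⇒≡ u i v j t
  ... | refl , refl = trans (jordanSum-R-R-same-layer k l u i u)
    (cong (fibreSize *_) (cong₂ (λ a b → if does (k ≟F l) then 2 * a else b) (agreements-refl u) (disagreements-refl u)))
  jordanSum-R-R k l 1F u i v j t with S⇒same-layer u i v j t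
  ... | refl , u≢v = trans (jordanSum-R-R-same-layer k l u i v)
    (cong (fibreSize *_) (cong₂ (λ a b → if does (k ≟F l) then 2 * a else b) (agreements-distinct u v u≢v)
      (trans (x+n≡m⇒x≡m∸n _ _ _ (disagreements+agreements u v)) (cong (r ∸_) (agreements-distinct u v u≢v)))))
  jordanSum-R-R k l (fsuc (fsuc e)) u i v j t =
    cong₂ _+_ (meet-R-R-other-layer k l u i v j i≢j) (meet-R-R-other-layer l k u i v j i≢j)
    where
    i≢j : i ≢ j
    i≢j = Rel⇒layers≢ (τ e) u i v j t

  jordanSum-on-class : ∀ c c′ e u i v j → T (𝒞 e (u , i) (v , j)) →
    jordanSum (𝒞 c) (𝒞 c′) (u , i) (v , j) ≡ jordanNumber c c′ e
  jordanSum-on-class 0F c′ e u i v j t = cong₂ _+_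
    (trans (meet-Oneˡ (𝒞 c′) u i (v , j)) (⟦𝒞⟧-on-class c′ e u i v j t))
    (trans (meet-Oneʳ (𝒞 c′) (u , i) v j) (⟦𝒞⟧-on-class c′ e u i v j t))
  jordanSum-on-class (fsuc c) 0F e u i v j t = cong₂ _+_
    (trans (meet-Oneʳ (𝒞 (fsuc c)) (u , i) v j) (⟦𝒞⟧-on-class (fsuc c) e u i v j t))
    (trans (meet-Oneˡ (𝒞 (fsuc c)) u i (v , j)) (⟦𝒞⟧-on-class (fsuc c) e u i v j t))
  jordanSum-on-class 1F 1F e u i v j t = jordanSum-S-S e u i v j t
  jordanSum-on-class 1F (fsuc (fsuc l)) e u i v j t = jordanSum-S-R l e u i v j t
  jordanSum-on-class (fsuc (fsuc k)) 1F e u i v j t =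
    trans (+-comm (meet (allΩ d r) (R k) S (u , i) (v , j)) _) (jordanSum-S-R k e u i v j t)
  jordanSum-on-class (fsuc (fsuc k)) (fsuc (fsuc l)) e u i v j t = jordanSum-R-R k l e u i v j t

  πx-onto : ∀ n → n ≢ fzero → IsSurjective (πx π n)
  πx-onto fzero n≢0 = ⊥-elim (n≢0 refl)
  πx-onto (fsuc h) _ = π-onto h

  R-covers : ∀ u i v j → i ≢ j → ∃[ k ] T (R k (u , i) (v , j))
  R-covers u i v j i≢j with <-cmp i j
  ... | tri≈ _ i≡j _ = ⊥-elim (i≢j i≡j)
  ... | tri< _ _ _ = let (k , hit) = cyc^-reaches (θ i j) (σ i j ⟨$⟩ʳ πx π (i ⋄ j) u) (πx π (j ⋄ i) v)
                     in k , does-T (cyc^ k (θ i j) (σ i j ⟨$⟩ʳ πx π (i ⋄ j) u) ≟F πx π (j ⋄ i) v) hit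
  ... | tri> _ _ _ = let (k , hit) = cyc^-reaches (θ j i) (σ j i ⟨$⟩ʳ πx π (j ⋄ i) v) (πx π (i ⋄ j) u)
                     in k , does-T (cyc^ k (θ j i) (σ j i ⟨$⟩ʳ πx π (j ⋄ i) v) ≟F πx π (i ⋄ j) u) hit

  One-refl : ∀ (α : Ω d r) → T (One α α)
  One-refl (u , i) = Equivalence.from T-∧ (does-T (i ≟F i) refl , does-T (u ≟V u) refl)

  S-intro : ∀ (u v : V d) (i : Fin (suc r)) → u ≢ v → T (S (u , i) (v , i))
  S-intro u v i u≢v = Equivalence.from T-∧ (does-T (i ≟F i) refl , Equivalence.from T-not-≡ (dec-false (u ≟V v) u≢v))

  𝒞-covers : ∀ α β → ∃[ c ] T (𝒞 c α β)
  𝒞-covers (u , i) (v , j) with i ≟F j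
  ... | no i≢j = let (k , t) = R-covers u i v j i≢j in fsuc (fsuc k) , t
  ... | yes refl with u ≟V v
  ...   | yes refl = 0F , One-refl (u , i)
  ...   | no u≢v = 1F , S-intro u v i u≢v

  𝒞-nonempty : (z z′ : V d) → z ≢ z′ → Fin r → ∀ c → ∃[ α ] ∃[ β ] T (𝒞 c α β)
  𝒞-nonempty z z′ z≢z′ h 0F = (z , fzero) , (z , fzero) , One-refl (z , fzero)
  𝒞-nonempty z z′ z≢z′ h 1F = (z , fzero) , (z′ , fzero) , S-intro z z′ fzero z≢z′
  𝒞-nonempty z z′ z≢z′ h (fsuc (fsuc k)) =
    (z , fzero) , (w , fsuc h) , subst T (sym (R≡target k z w fzero (fsuc h) (λ ()))) (does-T (πx π n w ≟F t) πx[w]≡t)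
    where
    n : Fin (suc r)
    n = fsuc h ⋄ fzero
    t : Fin 3
    t = target k z fzero (fsuc h)
    w : V d
    w = proj₁ (πx-onto n (⋄≢0 (fsuc h) fzero (λ ())) t)
    πx[w]≡t : πx π n w ≡ t
    πx[w]≡t = proj₂ (πx-onto n (⋄≢0 (fsuc h) fzero (λ ())) t)

  𝒞-symmetric : ∀ c α β → 𝒞 c α β ≡ 𝒞 c β α
  𝒞-symmetric 0F (u , i) (v , j) = cong₂ _∧_ (does-sym _≟F_ i j) (does-sym _≟V_ u v)
  𝒞-symmetric 1F (u , i) (v , j) = cong₂ _∧_ (does-sym _≟F_ i j) (cong not (does-sym _≟V_ u v))
  𝒞-symmetric (fsuc (fsuc k)) (u , i) (v , j) = Rel-sym (τ k) u i v j

  𝒞-diagonal-or-off : ∀ c → (∀ α β → T (𝒞 c α β) → α ≡ β) ⊎ (∀ α β → T (𝒞 c α β) → α ≢ β)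
  𝒞-diagonal-or-off 0F = inj₁ λ { (u , i) (v , j) t → let (i≡j , u≡v) = One⇒≡ u i v j t in cong₂ _,_ u≡v i≡j }
  𝒞-diagonal-or-off 1F = inj₂ λ { (u , i) (v , j) t α≡β → proj₂ (S⇒same-layer u i v j t) (cong proj₁ α≡β) }
  𝒞-diagonal-or-off (fsuc (fsuc k)) = inj₂ λ { (u , i) (v , j) t α≡β → Rel⇒layers≢ (τ k) u i v j t (cong proj₂ α≡β) }

  One⇔≡ : ∀ (α β : Ω d r) → T (One α β) ⇔ (α ≡ β)
  One⇔≡ (u , i) (v , j) = mk⇔ (λ t → let (i≡j , u≡v) = One⇒≡ u i v j t in cong₂ _,_ u≡v i≡j) (λ { refl → One-refl (u , i) })

  𝒞-isJordanScheme : (z z′ : V d) → z ≢ z′ → Fin r → IsJordanScheme (allΩ d r) 𝒞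
  𝒞-isJordanScheme z z′ z≢z′ h =
    (((𝒞-nonempty z z′ z≢z′ h , 𝒞-covers , disjoint) , 𝒞-diagonal-or-off , transposes) , jordan) , (0F , One⇔≡)
    where
    disjoint : ∀ α β c c′ → T (𝒞 c α β) → T (𝒞 c′ α β) → c ≡ c′
    disjoint (u , i) (v , j) c c′ = 𝒞-disjoint c c′ u i v j
    transposes : ∀ c → ∃[ c′ ] (∀ α β → T (𝒞 c′ α β) ⇔ T (𝒞 c β α))
    transposes c = c , λ α β → mk⇔ (subst T (𝒞-symmetric c α β)) (subst T (𝒞-symmetric c β α))
    jordan : ∀ c c′ e α β α′ β′ → T (𝒞 e α β) → T (𝒞 e α′ β′) →
      jordanSum (𝒞 c) (𝒞 c′) α β ≡ jordanSum (𝒞 c) (𝒞 c′) α′ β′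
    jordan c c′ e (u , i) (v , j) (u′ , i′) (v′ , j′) t t′ =
      trans (jordanSum-on-class c c′ e u i v j t) (sym (jordanSum-on-class c c′ e u′ i′ v′ j′ t′))

3*n≢1 : ∀ n → 3 * n ≢ 1
3*n≢1 zero ()
3*n≢1 (suc n) 3n≡1 with () ← m+n≡0⇒n≡0 n (suc-injective 3n≡1)

theorem4p2 : (d : ℕ) → 1 ≤ d → (r : ℕ) → 2 * r + 1 ≡ 3 ^ d →
    (π : Fin r → V d → Fin 3) →
    (∀ i → IsLinear (π i)) → (∀ i → IsSurjective (π i)) →
    (∀ i j → i ≢ j → ¬ SameKernel (π i) (π j)) →
    (∀ (f : V d → Fin 3) → IsLinear f → IsSurjective f → ∃[ i ] SameKernel f (π i)) →
    (_⋄_ : Fin (suc r) → Fin (suc r) → Fin (suc r)) →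
    (∀ a → a ⋄ a ≡ fzero) → (∀ a → Bijective _≡_ _≡_ (a ⋄_)) →
    (σ : Fin (suc r) → Fin (suc r) → Permutation′ 3) →
    (θ : Fin (suc r) → Fin (suc r) → Bool) →
    IsJordanScheme (allΩ d r) (classes π _⋄_ σ θ)
theorem4p2 (suc d) _ zero 1≡3^d _ _ _ _ _ _ _ _ _ _ = ⊥-elim (3*n≢1 (3 ^ d) (sym 1≡3^d))
theorem4p2 (suc d) _ (suc r) _ π π-linear π-onto π-distinct π-complete _⋄_ ⋄-diagonal ⋄-bijective σ θ =
  IsJordanScheme-cong (allΩ (suc d) (suc r)) (λ c α β → sym (classes≗𝒞 c α β))
    (𝒞-isJordanScheme 0V (1F ∷ 0V) (λ ()) fzero)
  where open Construction π π-linear π-onto π-distinct π-complete _⋄_ ⋄-diagonal ⋄-bijective σ θ
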